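{- Let $S=(S_1,\dots,S_m)\in\mathsf{SVW}_{2,m}$. Suppose that in the $1$-word of $S$ the combined form, if it exists, starts in position $i_0$ and ends in position $j_0$, and that there are exactly $t$ left forms, starting in positions $i_1<\dots<i_t$ and ending in positions $j_1<\dots<j_t$. Then $E_1(S)$ is obtained from $S$ by removing $2$ from each of the sets $S_{j_0}$ (only if the combined form exists), $S_{j_1},\dots,S_{j_t}$, and adding $1$ to each of the sets $S_{i_1},\dots,S_{i_t}$.
   Context: $\mathsf{SVW}_{2,m}$ is the set of $m$-tuples $S=(S_1,\dots,S_m)$ of subsets of $\{1,2\}$, regarded as a $\sqrt{\mathfrak{gl}_2}$-crystal by identifying $S$ with $S_1\otimes\cdots\otimes S_m$, where on a single subset $T\subseteq\{1,2\}$: $\mathrm{wt}(T)=\sum_{j\in T}\mathbf{e}_j\in\mathbb{Z}^2$, $e_1(T)=\{1,2\}$ if $T=\{2\}$, $e_1(T)=\{1\}$ if $T=\{1,2\}$, else $0$; $f_1(T)=\{1,2\}$ if $T=\{1\}$, $f_1(T)=\{2\}$ if $T=\{1,2\}$, else $0$; and the tensor product rule is $e_1(b\otimes c)=b\otimes e_1(c)$ if $\varepsilon_1(b)\le\varphi_1(c)$ else $e_1(b)\otimes c$, $f_1(b\otimes c)=b\otimes f_1(c)$ if $\varepsilon_1(b)<\varphi_1(c)$ else $f_1(b)\otimes c$, where $\varepsilon_1(b)=\sup\{k:e_1^k(b)\ne0\}$, $\varphi_1(b)=\sup\{k:f_1^k(b)\ne0\}$, $b\otimes0=0\otimes c=0$,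 and weights add. $E_1(S):=e_1^{\varepsilon_1(S)}(S)$. The $1$-word of $S$ is the word in the characters "(", ")", "$-$" obtained by reading $S_1,\dots,S_m$ left to right and writing ")" for each $S_j=\{1\}$, "(" for each $S_j=\{2\}$, the three characters ")$-$(" for each $S_j=\{1,2\}$, and nothing for $S_j=\emptyset$. Its characters are partitioned into the equivalence classes generated by: ignoring "$-$" and matching parentheses in the usual way, each matched "(" and ")" together with everything between them lie in one class; and the three characters of each ")$-$(" lie in one class. Each class is a contiguous subword. A class is a null form if it has no unmatched parentheses; a left form if it has no unmatched ")" and ends with an unmatched "("; a right form if it has no unmatched "(" and starts with an unmatched ")"; a combined form if it starts with an unmatched ")" and ends with an unmatched "(" (there is at most one). A class starts (ends) in position $j$ if its first (last) parenthesis is contributed by $S_j$. -}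

module Defs where

open import Data.Bool using (Bool; true; false; if_then_else_)
open import Data.Nat using (ℕ; zero; suc; _+_; _*_; _∸_; _≤_; _<_; _≤ᵇ_; _<ᵇ_)
open import Data.Fin using (Fin)
open import Data.Fin.Subset using (Subset; inside; outside)
open import Data.Vec using (Vec; []; _∷_; lookup)
open import Data.List using (List; []; _∷_; _++_; map; drop; take)
open import Data.Maybe using (Maybe; just; nothing)
import Data.Maybe as Maybe
open import Data.Product using (_×_; _,_; ∃; ∃-syntax; proj₁)
open import Data.Sum using (_⊎_)
open import Relation.Binary.PropositionalEquality using (_≡_)
open import Relation.Nullary using (¬_)
open import Function.Bundles using (_⇔_)
open import Relation.Binary.Construct.Closure.Equivalence using (EqClosure)

-- Subsets of {1,2} are `Subset 2`; index 0 (Fin.zero) stands for the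
-- element 1 and index 1 (Fin.suc Fin.zero) for the element 2.

one two : Fin 2
one = Fin.zero
two = Fin.suc Fin.zero

-- the single-subset crystal operators e₁, f₁ (nothing = 0)
e₁ : Subset 2 → Maybe (Subset 2)
e₁ (outside ∷ inside ∷ []) = just (inside ∷ inside ∷ [])
e₁ (inside ∷ inside ∷ [])  = just (inside ∷ outside ∷ [])
e₁ _ = nothing

f₁ : Subset 2 → Maybe (Subset 2)
f₁ (inside ∷ outside ∷ []) = just (inside ∷ inside ∷ [])
f₁ (inside ∷ inside ∷ [])  = just (outside ∷ inside ∷ [])
f₁ _ = nothing

-- count g n a : number of times g can be applied successively to a,
-- looking at most n steps ahead.  With n at least the (finite) supremum
-- sup{k : g^k(a) ≠ 0} this is exactly that supremum.
count : {A : Set} → (A → Maybe A) → ℕ → A → ℕ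
count g zero a = 0
count g (suc n) a with g a
... | nothing = 0
... | just b  = suc (count g n b)

iter : {A : Set} → (A → Maybe A) → ℕ → A → Maybe A
iter g zero a = just a
iter g (suc k) a with g a
... | nothing = nothing
... | just b  = iter g k b

-- ε₁, φ₁ on a single subset (every e₁/f₁-string there has length ≤ 2)
ε₁ : Subset 2 → ℕ
ε₁ = count e₁ 2

-- Elements of SVW_{2,m}: S = S₁ ⊗ (S₂ ⊗ (⋯ ⊗ Sₘ)) as a vector.
SVW : ℕ → Set
SVW m = Vec (Subset 2) m

-- f₁ and φ₁ on tensor products (tensor rule of the paper); each application
-- of f₁ moves one factor along {1} → {1,2} → {2}, so 2m steps of look-ahead
-- suffice to compute φ₁ = sup{k : f₁^k ≠ 0} on SVW_{2,m}.
mutual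
  fT : ∀ {m} → SVW m → Maybe (SVW m)
  fT [] = nothing
  fT (b ∷ c) =
    if ε₁ b <ᵇ φT c then Maybe.map (b ∷_) (fT c) else Maybe.map (_∷ c) (f₁ b)

  φT : ∀ {m} → SVW m → ℕ
  φT {m} c = countF (2 * m) c

  countF : ∀ {m} → ℕ → SVW m → ℕ
  countF zero c = 0
  countF (suc n) c with fT c
  ... | nothing = 0
  ... | just c′ = suc (countF n c′)

eT : ∀ {m} → SVW m → Maybe (SVW m)
eT [] = nothing
eT (b ∷ c) =
  if ε₁ b ≤ᵇ φT c then Maybe.map (b ∷_) (eT c) else Maybe.map (_∷ c) (e₁ b)

-- ε₁ on SVW_{2,m} (again 2m steps of look-ahead suffice)
εT : ∀ {m} → SVW m → ℕ
εT {m} S = count eT (2 * m) S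

E₁ : ∀ {m} → SVW m → Maybe (SVW m)
E₁ S = iter eT (εT S) S

-- The 1-word.  Each character remembers the position j (0-based, i.e.
-- j = paper's index − 1) of the S_j that contributed it.

data Sym : Set where
  opn cls dsh : Sym

Letter : ℕ → Set
Letter m = Sym × Fin m

letters : ∀ {m} → Subset 2 → Fin m → List (Letter m)
letters (inside ∷ outside ∷ []) j = (cls , j) ∷ []
letters (outside ∷ inside ∷ []) j = (opn , j) ∷ []
letters (inside ∷ inside ∷ [])  j = (cls , j) ∷ (dsh , j) ∷ (opn , j) ∷ []
letters (outside ∷ outside ∷ []) j = []

word : ∀ {m} → SVW m → List (Letter m)
word {m} S = go S (Data.Vec.allFin m)
  where
  go : ∀ {k} → Vec (Subset 2) k → Vec (Fin m) k → List (Letter m)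
  go [] [] = []
  go (s ∷ ss) (j ∷ js) = letters s j ++ go ss js

at : {A : Set} → List A → ℕ → Maybe A
at [] k = nothing
at (x ∷ xs) zero = just x
at (x ∷ xs) (suc k) = at xs k

balFrom : ℕ → List Sym → Bool
balFrom zero [] = true
balFrom (suc d) [] = false
balFrom d (opn ∷ xs) = balFrom (suc d) xs
balFrom zero (cls ∷ xs) = false
balFrom (suc d) (cls ∷ xs) = balFrom d xs
balFrom d (dsh ∷ xs) = balFrom d xs

Balanced : List Sym → Set
Balanced xs = balFrom 0 xs ≡ true

module OneWord {m : ℕ} (S : SVW m) where

  w : List (Letter m)
  w = word S

  symAt : ℕ → Maybe Sym
  symAt k = Maybe.map proj₁ (at w k)

  srcAt : ℕ → Maybe (Fin m)
  srcAt k = Maybe.map Data.Product.proj₂ (at w k)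

  Matched : ℕ → ℕ → Set
  Matched p q = p < q × symAt p ≡ just opn × symAt q ≡ just cls
              × Balanced (map proj₁ (take (q ∸ suc p) (drop (suc p) w)))

  UnmatchedOpen : ℕ → Set
  UnmatchedOpen k = symAt k ≡ just opn × (∀ q → ¬ Matched k q)

  UnmatchedClose : ℕ → Set
  UnmatchedClose k = symAt k ≡ just cls × (∀ p → ¬ Matched p k)

  data Gen : ℕ → ℕ → Set where
    inMatch : ∀ {a b} p q → Matched p q → p ≤ a → a ≤ q → p ≤ b → b ≤ q → Gen a b
    inTriple : ∀ {a b} j → lookup S j ≡ (inside ∷ inside ∷ [])
             → srcAt a ≡ just j → srcAt b ≡ just j → Gen a b

  Same : ℕ → ℕ → Set
  Same = EqClosure Gen

  Class : ℕ → ℕ → Set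
  Class lo hi = (k : ℕ) → Same lo k ⇔ (lo ≤ k × k ≤ hi)

  LeftForm : ℕ → ℕ → Set
  LeftForm lo hi = Class lo hi
                 × ((k : ℕ) → lo ≤ k → k ≤ hi → ¬ UnmatchedClose k)
                 × UnmatchedOpen hi

  CombinedForm : ℕ → ℕ → Set
  CombinedForm lo hi = Class lo hi × UnmatchedClose lo × UnmatchedOpen hi

  -- j is one of the starting positions i₁,…,i_t of the left forms
  StartOfLeft : Fin m → Set
  StartOfLeft j = ∃[ lo ] ∃[ hi ] LeftForm lo hi × srcAt lo ≡ just j

  -- j is one of j₁,…,j_t, or j₀ (if the combined form exists)
  EndOfLeftOrCombined : Fin m → Set
  EndOfLeftOrCombined j =
    ∃[ lo ] ∃[ hi ] (LeftForm lo hi ⊎ CombinedForm lo hi) × srcAt hi ≡ just j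

{-# OPTIONS --safe #-}

-- By the tensor product rule, ε₁ and φ₁ of S₁ ⊗ ⋯ ⊗ Sₘ satisfy the signature rule, and E₁ acts
-- factorwise: S_j becomes e₁ᵏ(S_j) with k = (ε₁(S_j) − φ₁(S_{j+1} ⊗ ⋯ ⊗ Sₘ))⁺.  Read the 1-word as
-- a walk, "(" one step up and ")" one step down.  The φ₁ of a tail is at most 2d exactly when the
-- walk of its word never falls more than d below its start, and at most 2d + 1 exactly when it
-- falls by d + 1 only just after the ")" or "−" of a ")−(".  Hence the "(" contributed by S_j is
-- unmatched (so ends a left form or the combined form, and 2 is removed) iff the tail has φ₁ = 0,
-- and a lone "(" starts a left form (and 1 is added) iff the walk after it comes back to its level
-- only inside ")−(" blocks, i.e. iff the tail has φ₁ ≤ 1.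

module Submission where

open import Defs
open import Data.Bool using (Bool; true; false; if_then_else_)
import Data.Bool.Properties as Bool
open import Data.Empty using (⊥; ⊥-elim)
open import Data.Fin as Fin using (Fin; zero; suc; toℕ)
open import Data.Fin.Subset using (Subset; _∈_; inside; outside)
open import Data.Integer as ℤ using (ℤ; +_; 0ℤ; 1ℤ; -1ℤ) renaming (suc to sucℤ; pred to predℤ)
import Data.Integer.Properties as ℤₚ
open import Algebra.Properties.AbelianGroup ℤₚ.+-0-abelianGroup using (\\-leftDividesʳ) renaming (∙-cancelˡ to +-cancelˡ-≡ℤ)
open import Algebra.Properties.CommutativeSemigroup ℤₚ.+-commutativeSemigroup using (x∙yz≈y∙xz)
open import Data.List using (List; []; _∷_; _++_; map; length; take; drop)
open import Data.List.Properties using (length-take; length-drop; map-++; length-map; length-++; ++-assoc; take-map; drop-map)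
open import Data.Maybe using (Maybe; just; nothing)
import Data.Maybe as Maybe
import Data.Maybe.Properties as Maybeₚ
open import Data.Nat
open import Data.Nat.Properties
open import Data.Product using (_×_; _,_; proj₁; proj₂; ∃-syntax; map₁)
open import Data.Sum using (_⊎_; inj₁; inj₂; [_,_]′)
open import Data.Vec using (Vec; []; _∷_; lookup; tabulate; allFin; here; there)
open import Function using (id; _∘_)
open import Function.Bundles using (_⇔_; mk⇔; Equivalence)
open import Function.Properties.Equivalence using () renaming (trans to ⇔-trans; sym to ⇔-sym)
open import Relation.Nullary using (¬_; ¬?; Dec; yes; no; does)
open import Relation.Nullary.Decidable using (dec-true; dec-false; _×-dec_; _⊎-dec_; decidable-stable)
open import Relation.Unary using (Decidable)
open import Relation.Binary.PropositionalEquality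
open import Relation.Binary.Construct.Closure.ReflexiveTransitive using (ε; _◅_; _◅◅_)
open import Relation.Binary.Construct.Closure.Symmetric using (fwd; bwd)
import Relation.Binary.Construct.Closure.Equivalence as EqClosure

-- The signature rule

module _ {A : Set} (g : A → Maybe A) where

  Counts : (A → ℕ) → A → Set
  Counts μ a = (g a ≡ nothing × μ a ≡ 0) ⊎ (∃[ a′ ] g a ≡ just a′ × μ a ≡ suc (μ a′))

  count-exact : ∀ {μ} → (∀ a → Counts μ a) → ∀ n a → μ a ≤ n → count g n a ≡ μ a
  count-exact counts zero a μa≤0 = sym (n≤0⇒n≡0 μa≤0)
  count-exact counts (suc n) a μa≤n with g a | counts a
  ... | nothing | inj₁ (_ , μa≡0) = sym μa≡0
  ... | just a′ | inj₂ (_ , refl , μa≡1+μa′) =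
    trans (cong suc (count-exact counts n a′ (s≤s⁻¹ (subst (_≤ suc n) μa≡1+μa′ μa≤n)))) (sym μa≡1+μa′)

  iter-+ : ∀ k l {a a′} → iter g k a ≡ just a′ → iter g (k + l) a ≡ iter g l a′
  iter-+ zero    l refl = refl
  iter-+ (suc k) l {a} eq with g a
  ... | just b = iter-+ k l eq

  iter-suc : ∀ k a {a′} → g a ≡ just a′ → iter g (suc k) a ≡ iter g k a′
  iter-suc k a eq with g a
  iter-suc k a refl | just _ = refl

  iter-stuck : ∀ k a → g a ≡ nothing → iter g (suc k) a ≡ nothing
  iter-stuck k a eq with g a
  iter-stuck k a refl | nothing = refl

countF≡count : ∀ {m} n (c : SVW m) → countF n c ≡ count fT n c
countF≡count zero    c = refl
countF≡count (suc n) c with fT c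
... | nothing = refl
... | just c′ = cong suc (countF≡count n c′)

φ₁ : Subset 2 → ℕ
φ₁ = count f₁ 2

φ₁≤2 : ∀ b → φ₁ b ≤ 2
φ₁≤2 (inside ∷ inside ∷ [])   = s≤s z≤n
φ₁≤2 (inside ∷ outside ∷ [])  = ≤-refl
φ₁≤2 (outside ∷ inside ∷ [])  = z≤n
φ₁≤2 (outside ∷ outside ∷ []) = z≤n

ε₁≤2 : ∀ b → ε₁ b ≤ 2
ε₁≤2 (inside ∷ inside ∷ [])   = s≤s z≤n
ε₁≤2 (inside ∷ outside ∷ [])  = z≤n
ε₁≤2 (outside ∷ inside ∷ [])  = ≤-refl
ε₁≤2 (outside ∷ outside ∷ []) = z≤n

+-∸-suc : ∀ a {b} p → b ≤ p → a + (suc p ∸ b) ≡ suc (a + (p ∸ b))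
+-∸-suc a {b} p b≤p = trans (cong (λ x → a + x) (+-∸-assoc 1 b≤p)) (+-suc a (p ∸ b))

φ⊗ : ∀ {m} → SVW m → ℕ
φ⊗ []      = 0
φ⊗ (b ∷ c) = φ₁ b + (φ⊗ c ∸ ε₁ b)

ε⊗ : ∀ {m} → SVW m → ℕ
ε⊗ []      = 0
ε⊗ (b ∷ c) = (ε₁ b ∸ φ⊗ c) + ε⊗ c

φ⊗≤2m : ∀ {m} (S : SVW m) → φ⊗ S ≤ 2 * m
φ⊗≤2m []            = z≤n
φ⊗≤2m {suc m} (b ∷ c) = begin
  φ₁ b + (φ⊗ c ∸ ε₁ b) ≤⟨ +-mono-≤ (φ₁≤2 b) (≤-trans (m∸n≤m (φ⊗ c) (ε₁ b)) (φ⊗≤2m c)) ⟩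
  2 + 2 * m            ≡⟨ *-suc 2 m ⟨
  2 * suc m            ∎
  where open ≤-Reasoning

ε⊗≤2m : ∀ {m} (S : SVW m) → ε⊗ S ≤ 2 * m
ε⊗≤2m []            = z≤n
ε⊗≤2m {suc m} (b ∷ c) = begin
  (ε₁ b ∸ φ⊗ c) + ε⊗ c ≤⟨ +-mono-≤ (≤-trans (m∸n≤m (ε₁ b) (φ⊗ c)) (ε₁≤2 b)) (ε⊗≤2m c) ⟩
  2 + 2 * m            ≡⟨ *-suc 2 m ⟨
  2 * suc m            ∎
  where open ≤-Reasoning

fT-counts-left : ∀ {m} b (c : SVW m) → φ⊗ c ≤ ε₁ b →
                 fT (b ∷ c) ≡ Maybe.map (_∷ c) (f₁ b) → Counts fT φ⊗ (b ∷ c)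
fT-counts-left (inside ∷ inside ∷ []) c φc≤1 eq = inj₂ (_ , eq ,
  cong suc (trans (m≤n⇒m∸n≡0 φc≤1) (sym (m≤n⇒m∸n≡0 (m≤n⇒m≤1+n φc≤1)))))
fT-counts-left (inside ∷ outside ∷ []) c φc≤0 eq = inj₂ (_ , eq ,
  cong (λ x → 2 + x) (trans (n≤0⇒n≡0 φc≤0) (sym (m≤n⇒m∸n≡0 (m≤n⇒m≤1+n φc≤0)))))
fT-counts-left (outside ∷ inside ∷ []) c φc≤2 eq = inj₁ (eq , m≤n⇒m∸n≡0 φc≤2)
fT-counts-left (outside ∷ outside ∷ []) c φc≤0 eq = inj₁ (eq , m≤n⇒m∸n≡0 φc≤0)

mutual
  fT-counts : ∀ {m} (S : SVW m) → Counts fT φ⊗ S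
  fT-counts []      = inj₁ (refl , refl)
  fT-counts (b ∷ c) with ε₁ b <? φ⊗ c
  ... | no ε₁b≮φc = fT-counts-left b c (≮⇒≥ ε₁b≮φc) (fT-left b c ε₁b≮φc)
  ... | yes ε₁b<φc with fT c | fT-counts c | fT-right b c ε₁b<φc
  ...   | nothing | inj₁ (_ , φc≡0) | _ = ⊥-elim (n≮0 (subst (ε₁ b <_) φc≡0 ε₁b<φc))
  ...   | just c′ | inj₂ (_ , refl , φc≡1+φc′) | eq = inj₂ (b ∷ c′ , eq ,
    trans (cong (λ x → φ₁ b + (x ∸ ε₁ b)) φc≡1+φc′)
          (+-∸-suc (φ₁ b) (φ⊗ c′) (s≤s⁻¹ (subst (ε₁ b <_) φc≡1+φc′ ε₁b<φc))))

  fT-∷ : ∀ {m} b (c : SVW m) →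
         fT (b ∷ c) ≡ (if does (ε₁ b <? φ⊗ c) then Maybe.map (b ∷_) (fT c) else Maybe.map (_∷ c) (f₁ b))
  fT-∷ b c = cong (λ x → if ε₁ b <ᵇ x then Maybe.map (b ∷_) (fT c) else Maybe.map (_∷ c) (f₁ b)) (φT≡φ⊗ c)

  fT-right : ∀ {m} b (c : SVW m) → ε₁ b < φ⊗ c → fT (b ∷ c) ≡ Maybe.map (b ∷_) (fT c)
  fT-right b c ε₁b<φc =
    trans (fT-∷ b c) (cong (λ t → if t then Maybe.map (b ∷_) (fT c) else Maybe.map (_∷ c) (f₁ b))
                           (dec-true (ε₁ b <? φ⊗ c) ε₁b<φc))

  fT-left : ∀ {m} b (c : SVW m) → ε₁ b ≮ φ⊗ c → fT (b ∷ c) ≡ Maybe.map (_∷ c) (f₁ b)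
  fT-left b c ε₁b≮φc =
    trans (fT-∷ b c) (cong (λ t → if t then Maybe.map (b ∷_) (fT c) else Maybe.map (_∷ c) (f₁ b))
                           (dec-false (ε₁ b <? φ⊗ c) ε₁b≮φc))

  φT≡φ⊗ : ∀ {m} (S : SVW m) → φT S ≡ φ⊗ S
  φT≡φ⊗ {m} S = trans (countF≡count (2 * m) S) (count-exact fT fT-counts _ S (φ⊗≤2m S))

e₁-counts : ∀ b → Counts e₁ ε₁ b
e₁-counts (inside ∷ inside ∷ [])   = inj₂ (_ , refl , refl)
e₁-counts (inside ∷ outside ∷ [])  = inj₁ (refl , refl)
e₁-counts (outside ∷ inside ∷ [])  = inj₂ (_ , refl , refl)
e₁-counts (outside ∷ outside ∷ []) = inj₁ (refl , refl)

eT-∷ : ∀ {m} b (c : SVW m) →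
       eT (b ∷ c) ≡ (if does (ε₁ b ≤? φ⊗ c) then Maybe.map (b ∷_) (eT c) else Maybe.map (_∷ c) (e₁ b))
eT-∷ b c = cong (λ x → if ε₁ b ≤ᵇ x then Maybe.map (b ∷_) (eT c) else Maybe.map (_∷ c) (e₁ b)) (φT≡φ⊗ c)

eT-right : ∀ {m} b (c : SVW m) → ε₁ b ≤ φ⊗ c → eT (b ∷ c) ≡ Maybe.map (b ∷_) (eT c)
eT-right b c ε₁b≤φc =
  trans (eT-∷ b c) (cong (λ t → if t then Maybe.map (b ∷_) (eT c) else Maybe.map (_∷ c) (e₁ b))
                         (dec-true (ε₁ b ≤? φ⊗ c) ε₁b≤φc))

eT-left : ∀ {m} b (c : SVW m) → φ⊗ c < ε₁ b → eT (b ∷ c) ≡ Maybe.map (_∷ c) (e₁ b)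
eT-left b c φc<ε₁b =
  trans (eT-∷ b c) (cong (λ t → if t then Maybe.map (b ∷_) (eT c) else Maybe.map (_∷ c) (e₁ b))
                         (dec-false (ε₁ b ≤? φ⊗ c) (<⇒≱ φc<ε₁b)))

LowersεRaisesφ : ∀ {m} → SVW m → Set
LowersεRaisesφ S =
  (eT S ≡ nothing × ε⊗ S ≡ 0) ⊎ (∃[ S′ ] eT S ≡ just S′ × ε⊗ S ≡ suc (ε⊗ S′) × φ⊗ S′ ≡ suc (φ⊗ S))

eT-left-step : ∀ {m} b (c : SVW m) → φ⊗ c < ε₁ b →
               eT (b ∷ c) ≡ Maybe.map (_∷ c) (e₁ b) → LowersεRaisesφ (b ∷ c)
eT-left-step (inside ∷ inside ∷ []) c (s≤s φc≤0) eq =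
  inj₂ (_ , eq , ε-eq (φ⊗ c) φc≤0 , φ-eq (φ⊗ c) φc≤0)
  where
  ε-eq : ∀ p → p ≤ 0 → (1 ∸ p) + ε⊗ c ≡ suc ((0 ∸ p) + ε⊗ c)
  ε-eq zero _ = refl
  φ-eq : ∀ p → p ≤ 0 → 2 + (p ∸ 0) ≡ suc (1 + (p ∸ 1))
  φ-eq zero _ = refl
eT-left-step (outside ∷ inside ∷ []) c (s≤s φc≤1) eq =
  inj₂ (_ , eq , ε-eq (φ⊗ c) φc≤1 , φ-eq (φ⊗ c) φc≤1)
  where
  ε-eq : ∀ p → p ≤ 1 → (2 ∸ p) + ε⊗ c ≡ suc ((1 ∸ p) + ε⊗ c)
  ε-eq zero       _ = refl
  ε-eq (suc zero) _ = refl
  ε-eq (suc (suc _)) (s≤s ())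
  φ-eq : ∀ p → p ≤ 1 → 1 + (p ∸ 1) ≡ suc (0 + (p ∸ 2))
  φ-eq zero       _ = refl
  φ-eq (suc zero) _ = refl
  φ-eq (suc (suc _)) (s≤s ())

eT-step : ∀ {m} (S : SVW m) → LowersεRaisesφ S
eT-step []      = inj₁ (refl , refl)
eT-step (b ∷ c) with ε₁ b ≤? φ⊗ c
... | no ε₁b≰φc = eT-left-step b c (≰⇒> ε₁b≰φc) (eT-left b c (≰⇒> ε₁b≰φc))
... | yes ε₁b≤φc with eT c | eT-step c | eT-right b c ε₁b≤φc
...   | nothing | inj₁ (_ , εc≡0) | eq = inj₁ (eq , cong₂ _+_ (m≤n⇒m∸n≡0 ε₁b≤φc) εc≡0)
...   | just c′ | inj₂ (_ , refl , εc≡1+εc′ , φc′≡1+φc) | eq = inj₂ (b ∷ c′ , eq , ε-eq , φ-eq)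
  where
  ε₁b≤φc′ : ε₁ b ≤ φ⊗ c′
  ε₁b≤φc′ = subst (ε₁ b ≤_) (sym φc′≡1+φc) (m≤n⇒m≤1+n ε₁b≤φc)
  ε-eq : (ε₁ b ∸ φ⊗ c) + ε⊗ c ≡ suc ((ε₁ b ∸ φ⊗ c′) + ε⊗ c′)
  ε-eq rewrite m≤n⇒m∸n≡0 ε₁b≤φc | m≤n⇒m∸n≡0 ε₁b≤φc′ = εc≡1+εc′
  φ-eq : φ₁ b + (φ⊗ c′ ∸ ε₁ b) ≡ suc (φ₁ b + (φ⊗ c ∸ ε₁ b))
  φ-eq = trans (cong (λ x → φ₁ b + (x ∸ ε₁ b)) φc′≡1+φc) (+-∸-suc (φ₁ b) (φ⊗ c) ε₁b≤φc)

εT≡ε⊗ : ∀ {m} (S : SVW m) → εT S ≡ ε⊗ S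
εT≡ε⊗ S = count-exact eT counts _ S (ε⊗≤2m S)
  where
  counts : ∀ S → Counts eT ε⊗ S
  counts S with eT-step S
  ... | inj₁ stop                = inj₁ stop
  ... | inj₂ (S′ , eq , ε≡ , _) = inj₂ (S′ , eq , ε≡)

e₁^ : ℕ → Subset 2 → Subset 2
e₁^ zero    b = b
e₁^ (suc k) b with e₁ b
... | nothing = b
... | just b′ = e₁^ k b′

E⊗ : ∀ {m} → SVW m → SVW m
E⊗ []      = []
E⊗ (b ∷ c) = e₁^ (ε₁ b ∸ φ⊗ c) b ∷ E⊗ c

e₁^-suc : ∀ k {b b′} → e₁ b ≡ just b′ → e₁^ (suc k) b ≡ e₁^ k b′
e₁^-suc k {b} eq with e₁ b
e₁^-suc k refl | just _ = refl

iter-eT-left : ∀ {m} k b (c : SVW m) → k ≤ ε₁ b ∸ φ⊗ c → iter eT k (b ∷ c) ≡ just (e₁^ k b ∷ c)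
iter-eT-left zero    b c _ = refl
iter-eT-left (suc k) b c 1+k≤ε₁b∸φc with e₁-counts b
... | inj₁ (_ , ε₁b≡0) =
  ⊥-elim (n≮0 (subst (k <_) (0∸n≡0 (φ⊗ c)) (subst (λ x → k < x ∸ φ⊗ c) ε₁b≡0 1+k≤ε₁b∸φc)))
... | inj₂ (b′ , e₁b≡b′ , ε₁b≡1+ε₁b′) = begin
  iter eT (suc k) (b ∷ c)  ≡⟨ iter-suc eT k (b ∷ c) (trans (eT-left b c φc<ε₁b) (cong (Maybe.map (_∷ c)) e₁b≡b′)) ⟩
  iter eT k (b′ ∷ c)       ≡⟨ iter-eT-left k b′ c k≤ε₁b′∸φc ⟩
  just (e₁^ k b′ ∷ c)      ≡⟨ cong (λ x → just (x ∷ c)) (e₁^-suc k e₁b≡b′) ⟨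
  just (e₁^ (suc k) b ∷ c) ∎
  where
  open ≡-Reasoning
  φc<ε₁b : φ⊗ c < ε₁ b
  φc<ε₁b = m∸n≢0⇒n<m (λ ε₁b∸φc≡0 → n≮0 (subst (k <_) ε₁b∸φc≡0 1+k≤ε₁b∸φc))
  1+k+φc≤1+ε₁b′ : suc k + φ⊗ c ≤ suc (ε₁ b′)
  1+k+φc≤1+ε₁b′ = subst (suc k + φ⊗ c ≤_) ε₁b≡1+ε₁b′ (m≤o∸n⇒m+n≤o (suc k) (<⇒≤ φc<ε₁b) 1+k≤ε₁b∸φc)
  k≤ε₁b′∸φc : k ≤ ε₁ b′ ∸ φ⊗ c
  k≤ε₁b′∸φc = m+n≤o⇒m≤o∸n k (s≤s⁻¹ 1+k+φc≤1+ε₁b′)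

iter-eT-right : ∀ {m} k b (c : SVW m) → ε₁ b ≤ φ⊗ c → iter eT k (b ∷ c) ≡ Maybe.map (b ∷_) (iter eT k c)
iter-eT-right zero    b c _ = refl
iter-eT-right (suc k) b c ε₁b≤φc with eT-step c
... | inj₁ (eTc≡nothing , _) = begin
  iter eT (suc k) (b ∷ c)              ≡⟨ iter-stuck eT k (b ∷ c) (trans (eT-right b c ε₁b≤φc) (cong (Maybe.map (b ∷_)) eTc≡nothing)) ⟩
  nothing                              ≡⟨ cong (Maybe.map (b ∷_)) (iter-stuck eT k c eTc≡nothing) ⟨
  Maybe.map (b ∷_) (iter eT (suc k) c) ∎
  where open ≡-Reasoning
... | inj₂ (c′ , eTc≡c′ , _ , φc′≡1+φc) = begin
  iter eT (suc k) (b ∷ c)              ≡⟨ iter-suc eT k (b ∷ c) (trans (eT-right b c ε₁b≤φc) (cong (Maybe.map (b ∷_)) eTc≡c′)) ⟩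
  iter eT k (b ∷ c′)                   ≡⟨ iter-eT-right k b c′ (subst (ε₁ b ≤_) (sym φc′≡1+φc) (m≤n⇒m≤1+n ε₁b≤φc)) ⟩
  Maybe.map (b ∷_) (iter eT k c′)      ≡⟨ cong (Maybe.map (b ∷_)) (iter-suc eT k c eTc≡c′) ⟨
  Maybe.map (b ∷_) (iter eT (suc k) c) ∎
  where open ≡-Reasoning

ε₁-e₁^ : ∀ b p → ε₁ (e₁^ (ε₁ b ∸ p) b) ≤ p
ε₁-e₁^ (outside ∷ inside ∷ []) zero             = z≤n
ε₁-e₁^ (outside ∷ inside ∷ []) (suc zero)       = ≤-refl
ε₁-e₁^ (outside ∷ inside ∷ []) (suc (suc p)) rewrite 0∸n≡0 p = s≤s (s≤s z≤n)
ε₁-e₁^ (inside ∷ inside ∷ [])  zero             = z≤n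
ε₁-e₁^ (inside ∷ inside ∷ [])  (suc p) rewrite 0∸n≡0 p = s≤s z≤n
ε₁-e₁^ (inside ∷ outside ∷ []) p rewrite 0∸n≡0 p = z≤n
ε₁-e₁^ (outside ∷ outside ∷ []) p rewrite 0∸n≡0 p = z≤n

iter-eT-ε⊗ : ∀ {m} (S : SVW m) → iter eT (ε⊗ S) S ≡ just (E⊗ S)
iter-eT-ε⊗ []      = refl
iter-eT-ε⊗ (b ∷ c) = begin
  iter eT (k + ε⊗ c) (b ∷ c)            ≡⟨ iter-+ eT k (ε⊗ c) (iter-eT-left k b c ≤-refl) ⟩
  iter eT (ε⊗ c) (e₁^ k b ∷ c)          ≡⟨ iter-eT-right (ε⊗ c) (e₁^ k b) c (ε₁-e₁^ b (φ⊗ c)) ⟩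
  Maybe.map (e₁^ k b ∷_) (iter eT (ε⊗ c) c) ≡⟨ cong (Maybe.map (e₁^ k b ∷_)) (iter-eT-ε⊗ c) ⟩
  just (e₁^ k b ∷ E⊗ c)                 ∎
  where
  open ≡-Reasoning
  k : ℕ
  k = ε₁ b ∸ φ⊗ c

E₁≡E⊗ : ∀ {m} (S : SVW m) → E₁ S ≡ just (E⊗ S)
E₁≡E⊗ S = trans (cong (λ k → iter eT k S) (εT≡ε⊗ S)) (iter-eT-ε⊗ S)

after : ∀ {A : Set} {m} → Vec A m → (j : Fin m) → Vec A (m ∸ suc (toℕ j))
after (b ∷ c) zero    = c
after (b ∷ c) (suc j) = after c j

lookup-E⊗ : ∀ {m} (S : SVW m) j →
            lookup (E⊗ S) j ≡ e₁^ (ε₁ (lookup S j) ∸ φ⊗ (after S j)) (lookup S j)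
lookup-E⊗ (b ∷ c) zero    = refl
lookup-E⊗ (b ∷ c) (suc j) = lookup-E⊗ c j

-- Levels of parenthesis words

module _ {P : ℕ → Set} (P? : Decidable P) where

  private
    least-≤ : ∀ b → (∃[ z ] z ≤ b × P z) → ∃[ y ] y ≤ b × P y × (∀ z → z < y → ¬ P z)
    least-≤ zero (z , z≤0 , Pz) = 0 , z≤n , subst P (n≤0⇒n≡0 z≤0) Pz , λ _ ()
    least-≤ (suc b) (z , z≤1+b , Pz) with anyUpTo? P? (suc b)
    ... | yes (x , x<1+b , Px) =
      let y , y≤b , Py , minimal = least-≤ b (x , s≤s⁻¹ x<1+b , Px) in y , m≤n⇒m≤1+n y≤b , Py , minimal
    ... | no none with m≤n⇒m<n∨m≡n z≤1+b
    ...   | inj₁ z<1+b = ⊥-elim (none (z , z<1+b , Pz))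
    ...   | inj₂ refl  = z , ≤-refl , Pz , λ x x<z Px → none (x , x<z , Px)

    greatest-≤ : ∀ c → (∃[ z ] z ≤ c × P z) → ∃[ y ] y ≤ c × P y × (∀ z → y < z → z ≤ c → ¬ P z)
    greatest-≤ c (z , z≤c , Pz) with P? c
    ... | yes Pc = c , ≤-refl , Pc , λ x c<x x≤c → ⊥-elim (<⇒≱ c<x x≤c)
    ... | no ¬Pc with m≤n⇒m<n∨m≡n z≤c
    ...   | inj₂ refl = ⊥-elim (¬Pc Pz)
    ...   | inj₁ z<c@(s≤s z≤c′) =
      let y , y≤c′ , Py , maximal = greatest-≤ _ (z , z≤c′ , Pz) in
      y , m≤n⇒m≤1+n y≤c′ , Py , λ x y<x x≤c → [ maximal x y<x ∘ s≤s⁻¹ , (λ { refl → ¬Pc }) ]′ (m≤n⇒m<n∨m≡n x≤c)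

  least : ∀ {b} → P b → ∃[ y ] y ≤ b × P y × (∀ z → z < y → ¬ P z)
  least {b} Pb = least-≤ b (b , ≤-refl , Pb)

  greatest : ∀ {a} c → a ≤ c → P a → ∃[ y ] a ≤ y × y ≤ c × P y × (∀ z → y < z → z ≤ c → ¬ P z)
  greatest {a} c a≤c Pa with greatest-≤ c (a , a≤c , Pa)
  ... | y , y≤c , Py , maximal = y , ≮⇒≥ (λ y<a → maximal a y<a a≤c Pa) , y≤c , Py , maximal

at-just⇒< : ∀ {A : Set} (xs : List A) k {x} → at xs k ≡ just x → k < length xs
at-just⇒< (_ ∷ xs) zero    _  = s≤s z≤n
at-just⇒< (_ ∷ xs) (suc k) eq = s≤s (at-just⇒< xs k eq)

at-<⇒just : ∀ {A : Set} (xs : List A) {k} → k < length xs → ∃[ x ] at xs k ≡ just x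
at-<⇒just (x ∷ xs) {zero}  _         = x , refl
at-<⇒just (x ∷ xs) {suc k} (s≤s k<n) = at-<⇒just xs k<n

at-++ˡ : ∀ {A : Set} (xs ys : List A) {k} → k < length xs → at (xs ++ ys) k ≡ at xs k
at-++ˡ (x ∷ xs) ys {zero}  _         = refl
at-++ˡ (x ∷ xs) ys {suc k} (s≤s k<n) = at-++ˡ xs ys k<n

at-++ʳ : ∀ {A : Set} (xs ys : List A) {n} k → length xs ≡ n → at (xs ++ ys) (n + k) ≡ at ys k
at-++ʳ []       ys k refl = refl
at-++ʳ (x ∷ xs) ys k refl = at-++ʳ xs ys k refl

at-map : ∀ {A B : Set} (f : A → B) xs k → at (map f xs) k ≡ Maybe.map f (at xs k)
at-map f []       k       = refl
at-map f (x ∷ xs) zero    = refl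
at-map f (x ∷ xs) (suc k) = at-map f xs k

drop-++ : ∀ {A : Set} (xs ys : List A) {n} → length xs ≡ n → drop n (xs ++ ys) ≡ ys
drop-++ []       ys refl = refl
drop-++ (x ∷ xs) ys refl = drop-++ xs ys refl

i<suc[i] : ∀ i → i ℤ.< sucℤ i
i<suc[i] i = ℤₚ.suc[i]≤j⇒i<j ℤₚ.≤-refl

pred[i]<i : ∀ i → predℤ i ℤ.< i
pred[i]<i i = ℤₚ.i≤pred[j]⇒i<j ℤₚ.≤-refl

i<suc[j]⇒i≤j : ∀ {i j} → i ℤ.< sucℤ j → i ℤ.≤ j
i<suc[j]⇒i≤j {i} {j} i<1+j = subst₂ ℤ._≤_ (ℤₚ.pred-suc i) (ℤₚ.pred-suc j) (ℤₚ.pred-mono (ℤₚ.i<j⇒suc[i]≤j i<1+j))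

+-cancelˡ-≤ℤ : ∀ d {a b} → d ℤ.+ a ℤ.≤ d ℤ.+ b → a ℤ.≤ b
+-cancelˡ-≤ℤ d {a} {b} le = subst₂ ℤ._≤_ (\\-leftDividesʳ d a) (\\-leftDividesʳ d b) (ℤₚ.+-monoʳ-≤ (ℤ.- d) le)

≡just-cls? : ∀ x → Dec (x ≡ just cls)
≡just-cls? (just opn) = no λ ()
≡just-cls? (just cls) = yes refl
≡just-cls? (just dsh) = no λ ()
≡just-cls? nothing    = no λ ()

move : Maybe Sym → ℤ → ℤ
move (just opn) = sucℤ
move (just cls) = predℤ
move (just dsh) = id
move nothing    = id

level : ℤ → List Sym → ℕ → ℤ
level z xs       zero    = z
level z []       (suc k) = z
level z (x ∷ xs) (suc k) = level (move (just x) z) xs k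

level-[] : ∀ z k → level z [] k ≡ z
level-[] z zero    = refl
level-[] z (suc k) = refl

level-suc : ∀ z xs k → level z xs (suc k) ≡ move (at xs k) (level z xs k)
level-suc z []       k       = sym (cong (move nothing) (level-[] z k))
level-suc z (x ∷ xs) zero    = refl
level-suc z (x ∷ xs) (suc k) = level-suc (move (just x) z) xs k

level-drop : ∀ z xs b i → level z xs (b + i) ≡ level (level z xs b) (drop b xs) i
level-drop z xs       zero    i = refl
level-drop z []       (suc b) i = sym (level-[] z i)
level-drop z (x ∷ xs) (suc b) i = level-drop (move (just x) z) xs b i

level-take : ∀ z xs a i → i ≤ a → level z (take a xs) i ≡ level z xs i
level-take z xs       a       zero    _         = refl
level-take z []       (suc a) (suc i) _         = refl
level-take z (x ∷ xs) (suc a) (suc i) (s≤s i≤a) = level-take (move (just x) z) xs a i i≤a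

move-translate : ∀ m d z → move m (d ℤ.+ z) ≡ d ℤ.+ move m z
move-translate (just opn) d z = x∙yz≈y∙xz 1ℤ d z
move-translate (just cls) d z = x∙yz≈y∙xz -1ℤ d z
move-translate (just dsh) d z = refl
move-translate nothing    d z = refl

level-translate : ∀ d z xs k → level (d ℤ.+ z) xs k ≡ d ℤ.+ level z xs k
level-translate d z xs       zero    = refl
level-translate d z []       (suc k) = refl
level-translate d z (x ∷ xs) (suc k) =
  trans (cong (λ w → level w xs k) (move-translate (just x) d z)) (level-translate d (move (just x) z) xs k)

level-from : ∀ z xs k → level z xs k ≡ z ℤ.+ level 0ℤ xs k
level-from z xs k = trans (cong (λ w → level w xs k) (sym (ℤₚ.+-identityʳ z))) (level-translate z 0ℤ xs k)

Nonnegative : ℤ → List Sym → Set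
Nonnegative z xs = ∀ i → i ≤ length xs → 0ℤ ℤ.≤ level z xs i

cons-nonnegative : ∀ {z} x xs → 0ℤ ℤ.≤ z → Nonnegative (move (just x) z) xs → Nonnegative z (x ∷ xs)
cons-nonnegative x xs 0≤z nonneg zero    _         = 0≤z
cons-nonnegative x xs 0≤z nonneg (suc i) (s≤s i≤n) = nonneg i i≤n

tail-nonnegative : ∀ {z} x xs → Nonnegative z (x ∷ xs) → Nonnegative (move (just x) z) xs
tail-nonnegative x xs nonneg i i≤n = nonneg (suc i) (s≤s i≤n)

balanced⇒ : ∀ d xs → balFrom d xs ≡ true → Nonnegative (+ d) xs × level (+ d) xs (length xs) ≡ 0ℤ
balanced⇒ zero    []         refl = (λ { zero _ → ℤₚ.≤-refl }) , refl
balanced⇒ (suc d) []         ()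
balanced⇒ zero    (cls ∷ xs) ()
balanced⇒ zero    (opn ∷ xs) bal  = map₁ (cons-nonnegative opn xs (ℤ.+≤+ z≤n)) (balanced⇒ 1 xs bal)
balanced⇒ (suc d) (opn ∷ xs) bal  = map₁ (cons-nonnegative opn xs (ℤ.+≤+ z≤n)) (balanced⇒ (2 + d) xs bal)
balanced⇒ (suc d) (cls ∷ xs) bal  = map₁ (cons-nonnegative cls xs (ℤ.+≤+ z≤n)) (balanced⇒ d xs bal)
balanced⇒ zero    (dsh ∷ xs) bal  = map₁ (cons-nonnegative dsh xs (ℤ.+≤+ z≤n)) (balanced⇒ 0 xs bal)
balanced⇒ (suc d) (dsh ∷ xs) bal  = map₁ (cons-nonnegative dsh xs (ℤ.+≤+ z≤n)) (balanced⇒ (suc d) xs bal)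

balanced⇐ : ∀ d xs → Nonnegative (+ d) xs → level (+ d) xs (length xs) ≡ 0ℤ → balFrom d xs ≡ true
balanced⇐ zero    []         _      _     = refl
balanced⇐ (suc d) []         _      ()
balanced⇐ zero    (opn ∷ xs) nonneg final = balanced⇐ 1 xs (tail-nonnegative opn xs nonneg) final
balanced⇐ (suc d) (opn ∷ xs) nonneg final = balanced⇐ (2 + d) xs (tail-nonnegative opn xs nonneg) final
balanced⇐ zero    (cls ∷ xs) nonneg _     with nonneg 1 (s≤s z≤n)
... | ()
balanced⇐ (suc d) (cls ∷ xs) nonneg final = balanced⇐ d xs (tail-nonnegative cls xs nonneg) final
balanced⇐ zero    (dsh ∷ xs) nonneg final = balanced⇐ 0 xs (tail-nonnegative dsh xs nonneg) final
balanced⇐ (suc d) (dsh ∷ xs) nonneg final = balanced⇐ (suc d) xs (tail-nonnegative dsh xs nonneg) final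

move-up : ∀ m {x ℓ} → x ℤ.≤ ℓ → ℓ ℤ.< move m x → m ≡ just opn × x ≡ ℓ
move-up (just opn) x≤ℓ ℓ<1+x = refl , ℤₚ.≤-antisym x≤ℓ (i<suc[j]⇒i≤j ℓ<1+x)
move-up (just cls) x≤ℓ ℓ<x-1 = ⊥-elim (ℤₚ.<⇒≱ (ℤₚ.<-trans ℓ<x-1 (pred[i]<i _)) x≤ℓ)
move-up (just dsh) x≤ℓ ℓ<x   = ⊥-elim (ℤₚ.<⇒≱ ℓ<x x≤ℓ)
move-up nothing    x≤ℓ ℓ<x   = ⊥-elim (ℤₚ.<⇒≱ ℓ<x x≤ℓ)

move-down : ∀ m {x ℓ} → ℓ ℤ.< x → move m x ℤ.≤ ℓ → m ≡ just cls × move m x ≡ ℓ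
move-down (just opn) ℓ<x 1+x≤ℓ = ⊥-elim (ℤₚ.<⇒≱ (ℤₚ.<-trans ℓ<x (i<suc[i] _)) 1+x≤ℓ)
move-down (just cls) ℓ<x x-1≤ℓ = refl , ℤₚ.≤-antisym x-1≤ℓ (ℤₚ.i<j⇒i≤pred[j] ℓ<x)
move-down (just dsh) ℓ<x x≤ℓ   = ⊥-elim (ℤₚ.<⇒≱ ℓ<x x≤ℓ)
move-down nothing    ℓ<x x≤ℓ   = ⊥-elim (ℤₚ.<⇒≱ ℓ<x x≤ℓ)

module Parens (ws : List Sym) where

  H : ℕ → ℤ
  H = level 0ℤ ws

  H-suc : ∀ k → H (suc k) ≡ move (at ws k) (H k)
  H-suc = level-suc 0ℤ ws

  H-opn : ∀ {p} → at ws p ≡ just opn → H (suc p) ≡ sucℤ (H p)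
  H-opn {p} eq = trans (H-suc p) (cong (λ m → move m (H p)) eq)

  H-cls : ∀ {q} → at ws q ≡ just cls → H (suc q) ≡ predℤ (H q)
  H-cls {q} eq = trans (H-suc q) (cong (λ m → move m (H q)) eq)

  Matched : ℕ → ℕ → Set
  Matched p q = p < q × at ws p ≡ just opn × at ws q ≡ just cls
              × balFrom 0 (take (q ∸ suc p) (drop (suc p) ws)) ≡ true

  module Between {p q} (p<q : p < q) (q<n : q < length ws) (opn-p : at ws p ≡ just opn) where

    L : ℕ
    L = q ∸ suc p

    slice : List Sym
    slice = take L (drop (suc p) ws)

    length-slice : length slice ≡ L
    length-slice = begin
      length slice                       ≡⟨ length-take L (drop (suc p) ws) ⟩
      L ⊓ length (drop (suc p) ws)       ≡⟨ m≤n⇒m⊓n≡m L≤ ⟩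
      L                                  ∎
      where
      open ≡-Reasoning
      L≤ : L ≤ length (drop (suc p) ws)
      L≤ = subst (L ≤_) (sym (length-drop (suc p) ws)) (∸-monoˡ-≤ (suc p) (<⇒≤ q<n))

    H-slice : ∀ i → i ≤ L → H (suc p + i) ≡ sucℤ (H p) ℤ.+ level 0ℤ slice i
    H-slice i i≤L = begin
      H (suc p + i)                                      ≡⟨ level-drop 0ℤ ws (suc p) i ⟩
      level (H (suc p)) (drop (suc p) ws) i              ≡⟨ level-from (H (suc p)) (drop (suc p) ws) i ⟩
      H (suc p) ℤ.+ level 0ℤ (drop (suc p) ws) i         ≡⟨ cong₂ ℤ._+_ (H-opn opn-p) (sym (level-take 0ℤ (drop (suc p) ws) L i i≤L)) ⟩
      sucℤ (H p) ℤ.+ level 0ℤ slice i                    ∎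
      where open ≡-Reasoning

  matched-above : ∀ {p q z} → Matched p q → p < z → z ≤ q → H p ℤ.< H z
  matched-above {p} {q} {z} (p<q , opn-p , cls-q , bal) p<z z≤q = ℤₚ.suc[i]≤j⇒i<j (begin
    sucℤ (H p)                       ≡⟨ ℤₚ.+-identityʳ _ ⟨
    sucℤ (H p) ℤ.+ 0ℤ                ≤⟨ ℤₚ.+-monoʳ-≤ (sucℤ (H p)) (nonneg i (subst (i ≤_) (sym length-slice) i≤L)) ⟩
    sucℤ (H p) ℤ.+ level 0ℤ slice i  ≡⟨ H-slice i i≤L ⟨
    H (suc p + i)                    ≡⟨ cong H (m+[n∸m]≡n p<z) ⟩
    H z                              ∎)
    where
    open Between p<q (at-just⇒< ws q cls-q) opn-p
    open ℤₚ.≤-Reasoning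
    i : ℕ
    i = z ∸ suc p
    i≤L : i ≤ L
    i≤L = ∸-monoˡ-≤ (suc p) z≤q
    nonneg : Nonnegative 0ℤ slice
    nonneg = proj₁ (balanced⇒ 0 slice bal)

  matched-closes : ∀ {p q} → Matched p q → H (suc q) ≡ H p
  matched-closes {p} {q} (p<q , opn-p , cls-q , bal) = begin
    H (suc q)                                ≡⟨ H-cls cls-q ⟩
    predℤ (H q)                              ≡⟨ cong (predℤ ∘ H) (m+[n∸m]≡n p<q) ⟨
    predℤ (H (suc p + L))                    ≡⟨ cong predℤ (H-slice L ≤-refl) ⟩
    predℤ (sucℤ (H p) ℤ.+ level 0ℤ slice L)  ≡⟨ cong (λ x → predℤ (sucℤ (H p) ℤ.+ x)) final ⟩
    predℤ (sucℤ (H p) ℤ.+ 0ℤ)                ≡⟨ cong predℤ (ℤₚ.+-identityʳ (sucℤ (H p))) ⟩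
    predℤ (sucℤ (H p))                       ≡⟨ ℤₚ.pred-suc (H p) ⟩
    H p                                      ∎
    where
    open Between p<q (at-just⇒< ws q cls-q) opn-p
    open ≡-Reasoning
    final : level 0ℤ slice L ≡ 0ℤ
    final = subst (λ k → level 0ℤ slice k ≡ 0ℤ) length-slice (proj₂ (balanced⇒ 0 slice bal))

  matched-intro : ∀ {p q} → p < q → at ws p ≡ just opn → at ws q ≡ just cls →
                  (∀ z → p < z → z ≤ q → H p ℤ.< H z) → H (suc q) ≡ H p → Matched p q
  matched-intro {p} {q} p<q opn-p cls-q above closes = p<q , opn-p , cls-q , balanced⇐ 0 slice nonneg final
    where
    open Between p<q (at-just⇒< ws q cls-q) opn-p
    1+p+L≡q : suc p + L ≡ q
    1+p+L≡q = m+[n∸m]≡n p<q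
    nonneg : Nonnegative 0ℤ slice
    nonneg i i≤len = +-cancelˡ-≤ℤ (sucℤ (H p)) (begin
      sucℤ (H p) ℤ.+ 0ℤ                ≡⟨ ℤₚ.+-identityʳ _ ⟩
      sucℤ (H p)                       ≤⟨ ℤₚ.i<j⇒suc[i]≤j (above (suc p + i) (s≤s (m≤m+n p i)) 1+p+i≤q) ⟩
      H (suc p + i)                    ≡⟨ H-slice i i≤L ⟩
      sucℤ (H p) ℤ.+ level 0ℤ slice i  ∎)
      where
      open ℤₚ.≤-Reasoning
      i≤L : i ≤ L
      i≤L = subst (i ≤_) length-slice i≤len
      1+p+i≤q : suc p + i ≤ q
      1+p+i≤q = subst (suc p + i ≤_) 1+p+L≡q (+-monoʳ-≤ (suc p) i≤L)
    final : level 0ℤ slice (length slice) ≡ 0ℤ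
    final = subst (λ k → level 0ℤ slice k ≡ 0ℤ) (sym length-slice) (+-cancelˡ-≡ℤ (sucℤ (H p)) _ _ (begin
      sucℤ (H p) ℤ.+ level 0ℤ slice L  ≡⟨ H-slice L ≤-refl ⟨
      H (suc p + L)                    ≡⟨ cong H 1+p+L≡q ⟩
      H q                              ≡⟨ ℤₚ.suc-pred (H q) ⟨
      sucℤ (predℤ (H q))               ≡⟨ cong sucℤ (trans (sym (H-cls cls-q)) closes) ⟩
      sucℤ (H p)                       ≡⟨ ℤₚ.+-identityʳ _ ⟨
      sucℤ (H p) ℤ.+ 0ℤ                ∎))
      where open ≡-Reasoning

  first-return : ∀ {p b} → at ws p ≡ just opn → p < b → H b ℤ.≤ H p → ∃[ q ] Matched p q × q < b
  first-return {p} {b} opn-p p<b Hb≤Hp with least (λ y → (p <? y) ×-dec (H y ℤₚ.≤? H p)) (p<b , Hb≤Hp)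
  ... | suc q , 1+q≤b , (p<1+q , H[1+q]≤Hp) , minimal = q , matched-intro p<q opn-p (proj₁ down) above closes , 1+q≤b
    where
    above : ∀ z → p < z → z ≤ q → H p ℤ.< H z
    above z p<z z≤q = ℤₚ.≰⇒> (λ Hz≤Hp → minimal z (s≤s z≤q) (p<z , Hz≤Hp))
    p<q : p < q
    p<q with m≤n⇒m<n∨m≡n (s≤s⁻¹ p<1+q)
    ... | inj₁ p<q = p<q
    ... | inj₂ refl = ⊥-elim (ℤₚ.<⇒≱ (subst (H p ℤ.<_) (sym (H-opn opn-p)) (i<suc[i] (H p))) H[1+q]≤Hp)
    down : at ws q ≡ just cls × move (at ws q) (H q) ≡ H p
    down = move-down (at ws q) (above q p<q ≤-refl) (subst (ℤ._≤ H p) (H-suc q) H[1+q]≤Hp)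
    closes : H (suc q) ≡ H p
    closes = trans (H-suc q) (proj₂ down)

  last-visit : ∀ {a k} → at ws k ≡ just cls → a ≤ k → H a ℤ.≤ H (suc k) → ∃[ p ] Matched p k
  last-visit {a} {k} cls-k a≤k Ha≤ℓ with greatest (λ y → H y ℤₚ.≤? H (suc k)) k a≤k Ha≤ℓ
  ... | p , _ , p≤k , Hp≤ℓ , maximal = p , matched-intro p<k (proj₁ up) cls-k above (sym (proj₂ up))
    where
    ℓ<H : ∀ z → p < z → z ≤ k → H (suc k) ℤ.< H z
    ℓ<H z p<z z≤k = ℤₚ.≰⇒> (maximal z p<z z≤k)
    p<k : p < k
    p<k with m≤n⇒m<n∨m≡n p≤k
    ... | inj₁ p<k = p<k
    ... | inj₂ refl = ⊥-elim (ℤₚ.<⇒≱ (subst (ℤ._< H p) (sym (H-cls cls-k)) (pred[i]<i (H p))) Hp≤ℓ)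
    up : at ws p ≡ just opn × H p ≡ H (suc k)
    up = move-up (at ws p) Hp≤ℓ (subst (H (suc k) ℤ.<_) (H-suc p) (ℓ<H (suc p) ≤-refl p<k))
    above : ∀ z → p < z → z ≤ k → H p ℤ.< H z
    above z p<z z≤k = subst (ℤ._< H z) (sym (proj₂ up)) (ℓ<H z p<z z≤k)

  Spanned : ℕ → Set
  Spanned c = ∃[ p ] ∃[ q ] Matched p q × p < c × c ≤ q

  spanning : ∀ {a c b} → a < c → c < b → H a ℤ.< H c → H b ℤ.≤ H a → Spanned c
  spanning {a} {suc c} {b} a<1+c 1+c<b Ha<H1+c Hb≤Ha
    with greatest (λ y → H y ℤₚ.≤? predℤ (H (suc c))) c (s≤s⁻¹ a<1+c) (ℤₚ.i<j⇒i≤pred[j] Ha<H1+c)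
  ... | p , _ , p≤c , Hp≤ℓ , maximal = p , q , Mpq , s≤s p≤c , 1+c≤q
    where
    ℓ<H : ∀ z → p < z → z ≤ suc c → predℤ (H (suc c)) ℤ.< H z
    ℓ<H z p<z z≤1+c with m≤n⇒m<n∨m≡n z≤1+c
    ... | inj₁ z<1+c = ℤₚ.≰⇒> (maximal z p<z (s≤s⁻¹ z<1+c))
    ... | inj₂ refl  = pred[i]<i _
    up : at ws p ≡ just opn × H p ≡ predℤ (H (suc c))
    up = move-up (at ws p) Hp≤ℓ (subst (predℤ (H (suc c)) ℤ.<_) (H-suc p) (ℓ<H (suc p) ≤-refl (s≤s p≤c)))
    Hb≤Hp : H b ℤ.≤ H p
    Hb≤Hp = ℤₚ.≤-trans Hb≤Ha (subst (H a ℤ.≤_) (sym (proj₂ up)) (ℤₚ.i<j⇒i≤pred[j] Ha<H1+c))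
    return : ∃[ q ] Matched p q × q < b
    return = first-return (proj₁ up) (<-trans (s≤s p≤c) 1+c<b) Hb≤Hp
    q : ℕ
    q = proj₁ return
    Mpq : Matched p q
    Mpq = proj₁ (proj₂ return)
    1+c≤q : suc c ≤ q
    1+c≤q = ≮⇒≥ λ q<1+c → ℤₚ.<-irrefl refl
      (subst (predℤ (H (suc c)) ℤ.<_) (trans (matched-closes Mpq) (proj₂ up)) (ℓ<H (suc q) (m<n⇒m<1+n (proj₁ Mpq)) q<1+c))

  no-match⇒above : ∀ {h} → at ws h ≡ just opn → (∀ q → ¬ Matched h q) → ∀ y → h < y → H h ℤ.< H y
  no-match⇒above {h} opn-h unmatched y h<y with H h ℤₚ.<? H y
  ... | yes Hh<Hy = Hh<Hy
  ... | no  Hh≮Hy = ⊥-elim (unmatched _ (proj₁ (proj₂ (first-return opn-h h<y (ℤₚ.≮⇒≥ Hh≮Hy)))))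

  above⇒no-match : ∀ {h} → (∀ y → h < y → H h ℤ.< H y) → ∀ q → ¬ Matched h q
  above⇒no-match above q Mhq = ℤₚ.<-irrefl (sym (matched-closes Mhq)) (above (suc q) (m<n⇒m<1+n (proj₁ Mhq)))

  no-match⇒below : ∀ {k} → at ws k ≡ just cls → (∀ p → ¬ Matched p k) → ∀ a → a ≤ k → H (suc k) ℤ.< H a
  no-match⇒below {k} cls-k unmatched a a≤k with H (suc k) ℤₚ.<? H a
  ... | yes H[1+k]<Ha = H[1+k]<Ha
  ... | no  H[1+k]≮Ha = ⊥-elim (unmatched _ (proj₂ (last-visit cls-k a≤k (ℤₚ.≮⇒≥ H[1+k]≮Ha))))

  below⇒no-match : ∀ {k} → (∀ a → a ≤ k → H (suc k) ℤ.< H a) → ∀ p → ¬ Matched p k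
  below⇒no-match below p Mpk = ℤₚ.<-irrefl (matched-closes Mpk) (below p (<⇒≤ (proj₁ Mpk)))

  spanned? : ∀ c → Dec (Spanned c)
  spanned? c with anyUpTo? (λ a → anyUpTo? (λ b → (c <? b) ×-dec (H a ℤₚ.<? H c) ×-dec (H b ℤₚ.≤? H a)) (suc (length ws))) c
  ... | yes (a , a<c , b , _ , c<b , Ha<Hc , Hb≤Ha) = yes (spanning a<c c<b Ha<Hc Hb≤Ha)
  ... | no none = no λ { (p , q , Mpq , p<c , c≤q) →
    none (p , p<c , suc q , s≤s (at-just⇒< ws q (proj₁ (proj₂ (proj₂ Mpq)))) , s≤s c≤q ,
          matched-above Mpq p<c c≤q , ℤₚ.≤-reflexive (matched-closes Mpq)) }

-- The 1-word of an element of SVW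

s∅ s1 s2 s12 : Subset 2
s∅  = outside ∷ outside ∷ []
s1  = inside ∷ outside ∷ []
s2  = outside ∷ inside ∷ []
s12 = inside ∷ inside ∷ []

-- The flag marks the characters glued to their predecessor inside a ")−(".
block : Subset 2 → List (Sym × Bool)
block (inside ∷ outside ∷ [])  = (cls , false) ∷ []
block (outside ∷ inside ∷ [])  = (opn , false) ∷ []
block (inside ∷ inside ∷ [])   = (cls , false) ∷ (dsh , true) ∷ (opn , true) ∷ []
block (outside ∷ outside ∷ []) = []

width : Subset 2 → ℕ
width s = length (block s)

blocks : ∀ {k} → Vec (Subset 2) k → List (Sym × Bool)
blocks []      = []
blocks (s ∷ S) = block s ++ blocks S

symbols : ∀ {k} → Vec (Subset 2) k → List Sym
symbols S = map proj₁ (blocks S)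

glued : ∀ {k} → Vec (Subset 2) k → ℕ → Maybe Bool
glued S i = Maybe.map proj₂ (at (blocks S) i)

offset : ∀ {m} → SVW m → Fin m → ℕ
offset (s ∷ S) zero    = 0
offset (s ∷ S) (suc j) = width s + offset S j

before : ∀ {m} → SVW m → Fin m → List (Sym × Bool)
before (s ∷ S) zero    = []
before (s ∷ S) (suc j) = block s ++ before S j

length-before : ∀ {m} (S : SVW m) j → length (before S j) ≡ offset S j
length-before (s ∷ S) zero    = refl
length-before (s ∷ S) (suc j) = trans (length-++ (block s)) (cong (λ x → width s + x) (length-before S j))

blocks-split : ∀ {m} (S : SVW m) j → blocks S ≡ before S j ++ block (lookup S j) ++ blocks (after S j)
blocks-split (s ∷ S) zero    = refl
blocks-split (s ∷ S) (suc j) = trans (cong (block s ++_) (blocks-split S j)) (sym (++-assoc (block s) (before S j) _))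

at-blocks : ∀ {m} (S : SVW m) j {r} → r < width (lookup S j) →
            at (blocks S) (offset S j + r) ≡ at (block (lookup S j)) r
at-blocks S j {r} r<w = begin
  at (blocks S) (offset S j + r)                                         ≡⟨ cong (λ xs → at xs (offset S j + r)) (blocks-split S j) ⟩
  at (before S j ++ block (lookup S j) ++ blocks (after S j)) (offset S j + r) ≡⟨ at-++ʳ (before S j) _ r (length-before S j) ⟩
  at (block (lookup S j) ++ blocks (after S j)) r                        ≡⟨ at-++ˡ (block (lookup S j)) _ r<w ⟩
  at (block (lookup S j)) r                                              ∎
  where open ≡-Reasoning

letters-symbols : ∀ {M} s (j : Fin M) → map proj₁ (letters s j) ≡ map proj₁ (block s)
letters-symbols (inside ∷ inside ∷ [])   j = refl
letters-symbols (inside ∷ outside ∷ [])  j = refl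
letters-symbols (outside ∷ inside ∷ [])  j = refl
letters-symbols (outside ∷ outside ∷ []) j = refl

length-letters : ∀ {M} s (j : Fin M) → length (letters s j) ≡ width s
length-letters (inside ∷ inside ∷ [])   j = refl
length-letters (inside ∷ outside ∷ [])  j = refl
length-letters (outside ∷ inside ∷ [])  j = refl
length-letters (outside ∷ outside ∷ []) j = refl

sourceAt : ∀ {M} → List (Letter M) → ℕ → Maybe (Fin M)
sourceAt w k = Maybe.map proj₂ (at w k)

letters-source : ∀ {M} s (j : Fin M) {r} → r < width s → sourceAt (letters s j) r ≡ just j
letters-source (inside ∷ inside ∷ [])  j {0} _ = refl
letters-source (inside ∷ inside ∷ [])  j {1} _ = refl
letters-source (inside ∷ inside ∷ [])  j {2} _ = refl
letters-source (inside ∷ inside ∷ [])  j {suc (suc (suc _))} (s≤s (s≤s (s≤s ())))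
letters-source (inside ∷ outside ∷ []) j {0} _ = refl
letters-source (inside ∷ outside ∷ []) j {suc _} (s≤s ())
letters-source (outside ∷ inside ∷ []) j {0} _ = refl
letters-source (outside ∷ inside ∷ []) j {suc _} (s≤s ())

sourceAt-letters-++ˡ : ∀ {M} s (j : Fin M) w {r} → r < width s → sourceAt (letters s j ++ w) r ≡ just j
sourceAt-letters-++ˡ s j w r<w =
  trans (cong (Maybe.map proj₂) (at-++ˡ (letters s j) w (subst (_ <_) (sym (length-letters s j)) r<w))) (letters-source s j r<w)

sourceAt-letters-++ʳ : ∀ {M} s (j : Fin M) w k → sourceAt (letters s j ++ w) (width s + k) ≡ sourceAt w k
sourceAt-letters-++ʳ s j w k = cong (Maybe.map proj₂) (at-++ʳ (letters s j) w k (length-letters s j))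

-- `word` is defined through a helper local to its `where` block; this metavariable is solved
-- by unification against the unfolding of `word` and so gives that helper a name.
mutual
  word-go : ∀ {M} → SVW M → ∀ {k} → Vec (Subset 2) k → Vec (Fin M) k → List (Letter M)
  word-go X = _

  private
    word-go-solved : ∀ {m} (S : SVW m) → word (s∅ ∷ S) ≡ word (s∅ ∷ S)
    word-go-solved {m} S with suc m | s∅ ∷ S | tabulate {n = m} Fin.suc
    ... | M | X | J = refl {x = word-go X S J}

word≡word-go : ∀ {m} (S : SVW m) → word S ≡ word-go S S (allFin m)
word≡word-go S = refl

word-go-symbols : ∀ {M} (X : SVW M) {k} (ss : Vec (Subset 2) k) js → map proj₁ (word-go X ss js) ≡ symbols ss
word-go-symbols X []       []       = refl
word-go-symbols X (s ∷ ss) (j ∷ js) = begin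
  map proj₁ (letters s j ++ word-go X ss js)               ≡⟨ map-++ proj₁ (letters s j) _ ⟩
  map proj₁ (letters s j) ++ map proj₁ (word-go X ss js)   ≡⟨ cong₂ _++_ (letters-symbols s j) (word-go-symbols X ss js) ⟩
  map proj₁ (block s) ++ symbols ss                        ≡⟨ map-++ proj₁ (block s) (blocks ss) ⟨
  symbols (s ∷ ss)                                         ∎
  where open ≡-Reasoning

word-go-source⇐ : ∀ {M} (X : SVW M) {k} (ss : Vec (Subset 2) k) (f : Fin k → Fin M) j {r} →
                  r < width (lookup ss j) → sourceAt (word-go X ss (tabulate f)) (offset ss j + r) ≡ just (f j)
word-go-source⇐ X (s ∷ ss) f zero    r<w = sourceAt-letters-++ˡ s (f zero) _ r<w
word-go-source⇐ X (s ∷ ss) f (suc j) {r} r<w =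
  trans (cong (sourceAt (letters s (f zero) ++ _)) (+-assoc (width s) _ r))
        (trans (sourceAt-letters-++ʳ s (f zero) _ _) (word-go-source⇐ X ss (f ∘ suc) j r<w))

word-go-source⇒ : ∀ {M} (X : SVW M) {k} (ss : Vec (Subset 2) k) (f : Fin k → Fin M) y {t} →
                  sourceAt (word-go X ss (tabulate f)) y ≡ just t →
                  ∃[ j ] f j ≡ t × offset ss j ≤ y × y < offset ss j + width (lookup ss j)
word-go-source⇒ X (s ∷ ss) f y eq with y <? width s
... | yes y<w = zero , Maybeₚ.just-injective (trans (sym (sourceAt-letters-++ˡ s (f zero) _ y<w)) eq) , z≤n , y<w
... | no y≮w with word-go-source⇒ X ss (f ∘ suc) (y ∸ width s)
  (trans (sym (sourceAt-letters-++ʳ s (f zero) (word-go X ss (tabulate (f ∘ suc))) (y ∸ width s)))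
         (trans (cong (sourceAt (letters s (f zero) ++ word-go X ss (tabulate (f ∘ suc)))) (m+[n∸m]≡n (≮⇒≥ y≮w))) eq))
...   | j , fj≡t , lo , hi = suc j , fj≡t , lo′ , hi′
  where
  y≡ : width s + (y ∸ width s) ≡ y
  y≡ = m+[n∸m]≡n (≮⇒≥ y≮w)
  lo′ : width s + offset ss j ≤ y
  lo′ = subst (width s + offset ss j ≤_) y≡ (+-monoʳ-≤ (width s) lo)
  hi′ : y < width s + offset ss j + width (lookup ss j)
  hi′ = subst₂ _<_ y≡ (sym (+-assoc (width s) _ _)) (+-monoʳ-< (width s) hi)

symbolAt flagAt : Subset 2 → ℕ → Maybe _
symbolAt s r = Maybe.map proj₁ (at (block s) r)
flagAt   s r = Maybe.map proj₂ (at (block s) r)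

opn-only-last : ∀ s r → r < width s → symbolAt s r ≡ just opn → r ≡ pred (width s)
opn-only-last (inside ∷ inside ∷ [])   0                   _ ()
opn-only-last (inside ∷ inside ∷ [])   1                   _ ()
opn-only-last (inside ∷ inside ∷ [])   2                   _ _ = refl
opn-only-last (inside ∷ inside ∷ [])   (suc (suc (suc _))) (s≤s (s≤s (s≤s ()))) _
opn-only-last (inside ∷ outside ∷ [])  0                   _ ()
opn-only-last (inside ∷ outside ∷ [])  (suc _)             (s≤s ()) _
opn-only-last (outside ∷ inside ∷ [])  0                   _ _ = refl
opn-only-last (outside ∷ inside ∷ [])  (suc _)             (s≤s ()) _
opn-only-last (outside ∷ outside ∷ []) _                   () _

flag-in-triple : ∀ s r → flagAt s r ≡ just true → s ≡ s12 × ∃[ r′ ] r ≡ suc r′ × r′ < 2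
flag-in-triple (inside ∷ inside ∷ [])   0                   ()
flag-in-triple (inside ∷ inside ∷ [])   1                   _ = refl , 0 , refl , s≤s z≤n
flag-in-triple (inside ∷ inside ∷ [])   2                   _ = refl , 1 , refl , s≤s (s≤s z≤n)
flag-in-triple (inside ∷ inside ∷ [])   (suc (suc (suc _))) ()
flag-in-triple (inside ∷ outside ∷ [])  0                   ()
flag-in-triple (inside ∷ outside ∷ [])  (suc _)             ()
flag-in-triple (outside ∷ inside ∷ [])  0                   ()
flag-in-triple (outside ∷ inside ∷ [])  (suc _)             ()
flag-in-triple (outside ∷ outside ∷ []) _                   ()

flagged-not-cls : ∀ s r → flagAt s r ≡ just true → symbolAt s r ≢ just cls
flagged-not-cls s r flagged with flag-in-triple s r flagged
flagged-not-cls _ 1 _ | refl , _ = λ ()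
flagged-not-cls _ 2 _ | refl , _ = λ ()

triple-start-not-opn : ∀ r → r < 2 → symbolAt s12 r ≢ just opn
triple-start-not-opn 0 _ ()
triple-start-not-opn 1 _ ()
triple-start-not-opn (suc (suc _)) (s≤s (s≤s ()))

triple-flagged : ∀ r → 0 < r → r < 3 → flagAt s12 r ≡ just true
triple-flagged 1 _ _ = refl
triple-flagged 2 _ _ = refl
triple-flagged (suc (suc (suc _))) _ (s≤s (s≤s (s≤s ())))

data Opener : Subset 2 → Set where
  lone-opn  : Opener (outside ∷ inside ∷ [])
  triple    : Opener (inside ∷ inside ∷ [])

suc-pred-width : ∀ {s} → Opener s → suc (pred (width s)) ≡ width s
suc-pred-width lone-opn = refl
suc-pred-width triple   = refl

pred-width< : ∀ {s} → Opener s → pred (width s) < width s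
pred-width< lone-opn = s≤s z≤n
pred-width< triple   = s≤s (s≤s (s≤s z≤n))

last-opn : ∀ {s} → Opener s → symbolAt s (pred (width s)) ≡ just opn
last-opn lone-opn = refl
last-opn triple   = refl

module Word {m} (S : SVW m) where

  private module O = OneWord S

  ws : List Sym
  ws = symbols S

  open Parens ws public

  lastPos : Fin m → ℕ
  lastPos j = offset S j + pred (width (lookup S j))

  symbols-word : map proj₁ (word S) ≡ ws
  symbols-word = trans (cong (map proj₁) (word≡word-go S)) (word-go-symbols S S (allFin m))

  symAt≡ : ∀ k → O.symAt k ≡ at ws k
  symAt≡ k = trans (sym (at-map proj₁ (word S) k)) (cong (λ xs → at xs k) symbols-word)

  slice≡ : ∀ p q → map proj₁ (take (q ∸ suc p) (drop (suc p) (word S))) ≡ take (q ∸ suc p) (drop (suc p) ws)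
  slice≡ p q = begin
    map proj₁ (take (q ∸ suc p) (drop (suc p) (word S)))  ≡⟨ take-map (q ∸ suc p) _ ⟨
    take (q ∸ suc p) (map proj₁ (drop (suc p) (word S)))  ≡⟨ cong (take (q ∸ suc p)) (drop-map (suc p) (word S)) ⟨
    take (q ∸ suc p) (drop (suc p) (map proj₁ (word S)))  ≡⟨ cong (λ xs → take (q ∸ suc p) (drop (suc p) xs)) symbols-word ⟩
    take (q ∸ suc p) (drop (suc p) ws)                    ∎
    where open ≡-Reasoning

  matched⇒ : ∀ {p q} → O.Matched p q → Matched p q
  matched⇒ {p} {q} (p<q , opn-p , cls-q , bal) =
    p<q , trans (sym (symAt≡ p)) opn-p , trans (sym (symAt≡ q)) cls-q , subst (λ xs → balFrom 0 xs ≡ true) (slice≡ p q) bal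

  matched⇐ : ∀ {p q} → Matched p q → O.Matched p q
  matched⇐ {p} {q} (p<q , opn-p , cls-q , bal) =
    p<q , trans (symAt≡ p) opn-p , trans (symAt≡ q) cls-q , subst (λ xs → balFrom 0 xs ≡ true) (sym (slice≡ p q)) bal

  source-block : ∀ {j r} → r < width (lookup S j) → O.srcAt (offset S j + r) ≡ just j
  source-block {j} = word-go-source⇐ S S id j

  source⇒block : ∀ {y j} → O.srcAt y ≡ just j → ∃[ r ] y ≡ offset S j + r × r < width (lookup S j)
  source⇒block {y} eq with word-go-source⇒ S S id y eq
  ... | j , refl , lo , hi = y ∸ offset S j , sym y≡ , +-cancelˡ-< (offset S j) _ _ (subst (_< offset S j + _) (sym y≡) hi)
    where
    y≡ : offset S j + (y ∸ offset S j) ≡ y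
    y≡ = m+[n∸m]≡n lo

  symbol-block : ∀ {j r} → r < width (lookup S j) → at ws (offset S j + r) ≡ symbolAt (lookup S j) r
  symbol-block {j} r<w = trans (at-map proj₁ (blocks S) _) (cong (Maybe.map proj₁) (at-blocks S j r<w))

  glued-block : ∀ {j r} → r < width (lookup S j) → glued S (offset S j + r) ≡ flagAt (lookup S j) r
  glued-block {j} r<w = cong (Maybe.map proj₂) (at-blocks S j r<w)

  length-word : length (word S) ≡ length ws
  length-word = trans (sym (length-map proj₁ (word S))) (cong length symbols-word)

  source⇒< : ∀ {y j} → O.srcAt y ≡ just j → y < length ws
  source⇒< {y} eq with at (word S) y in at≡
  ... | just _ = subst (y <_) length-word (at-just⇒< (word S) y at≡)

  glued⇒< : ∀ {y b} → glued S y ≡ just b → y < length ws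
  glued⇒< {y} eq with at (blocks S) y in at≡
  ... | just _ = subst (y <_) (sym (length-map proj₁ (blocks S))) (at-just⇒< (blocks S) y at≡)

  has-source : ∀ {y} → y < length ws → ∃[ j ] O.srcAt y ≡ just j
  has-source {y} y<n with at-<⇒just (word S) (subst (y <_) (sym length-word) y<n)
  ... | (_ , j) , at≡ = j , cong (Maybe.map proj₂) at≡

  opn⇒lastPos : ∀ {y j} → O.srcAt y ≡ just j → at ws y ≡ just opn → y ≡ lastPos j
  opn⇒lastPos {j = j} src opn-y with source⇒block src
  ... | r , refl , r<w = cong (λ x → offset S j + x) (opn-only-last (lookup S j) r r<w (trans (sym (symbol-block r<w)) opn-y))

  lone⇒lastPos : ∀ {y j} → lookup S j ≡ s2 → O.srcAt y ≡ just j → y ≡ lastPos j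
  lone⇒lastPos {j = j} S_j≡s2 src with source⇒block src
  ... | r , refl , r<w = cong (λ x → offset S j + x)
    (trans (n<1⇒n≡0 (subst (λ s → r < width s) S_j≡s2 r<w)) (sym (cong (pred ∘ width) S_j≡s2)))

  opener⇒lastPos : ∀ {j} → Opener (lookup S j) → O.srcAt (lastPos j) ≡ just j × at ws (lastPos j) ≡ just opn
  opener⇒lastPos op = source-block (pred-width< op) , trans (symbol-block (pred-width< op)) (last-opn op)

  source⇒nonempty : ∀ {y j} → O.srcAt y ≡ just j → lookup S j ≢ s∅
  source⇒nonempty src S_j≡∅ with source⇒block src
  ... | r , _ , r<w = n≮0 (subst (λ s → r < width s) S_j≡∅ r<w)

  glued⇒not-cls : ∀ {y} → glued S y ≡ just true → at ws y ≢ just cls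
  glued⇒not-cls g with has-source (glued⇒< g)
  ... | j , src with source⇒block src
  ... | r , refl , r<w = λ cls-y →
    flagged-not-cls (lookup S j) r (trans (sym (glued-block r<w)) g) (trans (sym (symbol-block r<w)) cls-y)

  <width-triple : ∀ {t r} → lookup S t ≡ s12 → r < 3 → r < width (lookup S t)
  <width-triple S_t≡s12 = subst (λ s → _ < width s) (sym S_t≡s12)

  glued-suc⇒triple : ∀ {y} → glued S (suc y) ≡ just true →
                     ∃[ t ] lookup S t ≡ s12 × ∃[ r ] y ≡ offset S t + r × r < 2
  glued-suc⇒triple {y} g with has-source (glued⇒< g)
  ... | t , src with source⇒block src
  ... | r , 1+y≡ , r<w with flag-in-triple (lookup S t) r (trans (sym (glued-block r<w)) (subst (λ x → glued S x ≡ just true) 1+y≡ g))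
  ... | S_t≡s12 , r′ , refl , r′<2 = t , S_t≡s12 , r′ , suc-injective (trans 1+y≡ (+-suc _ r′)) , r′<2

  glued-suc⇒not-opn : ∀ {y} → glued S (suc y) ≡ just true → at ws y ≢ just opn
  glued-suc⇒not-opn g with glued-suc⇒triple g
  ... | t , S_t≡s12 , r , refl , r<2 = λ opn-y → triple-start-not-opn r r<2
    (trans (cong (λ s → symbolAt s r) (sym S_t≡s12)) (trans (sym (symbol-block (<width-triple S_t≡s12 (m<n⇒m<1+n r<2)))) opn-y))

  glued-suc⇒same-triple : ∀ {y} → glued S (suc y) ≡ just true →
                          ∃[ t ] lookup S t ≡ s12 × O.srcAt y ≡ just t × O.srcAt (suc y) ≡ just t
  glued-suc⇒same-triple g with glued-suc⇒triple g
  ... | t , S_t≡s12 , r , refl , r<2 = t , S_t≡s12 , source-block (<width-triple S_t≡s12 (m<n⇒m<1+n r<2)) ,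
    subst (λ x → O.srcAt x ≡ just t) (+-suc (offset S t) r) (source-block (<width-triple S_t≡s12 (s≤s r<2)))

  same-triple⇒glued : ∀ {t a b c} → lookup S t ≡ s12 → O.srcAt a ≡ just t → O.srcAt b ≡ just t →
                      a < c → c ≤ b → glued S c ≡ just true
  same-triple⇒glued {t} {a} {b} {c} S_t≡s12 src-a src-b a<c c≤b
    with source⇒block src-a | source⇒block src-b
  ... | ra , refl , _ | rb , refl , rb<w = begin
    glued S c                              ≡⟨ cong (glued S) c≡ ⟨
    glued S (offset S t + (c ∸ offset S t)) ≡⟨ glued-block (≤-<-trans rc≤rb rb<w) ⟩
    flagAt (lookup S t) (c ∸ offset S t)   ≡⟨ cong (λ s → flagAt s (c ∸ offset S t)) S_t≡s12 ⟩
    flagAt s12 (c ∸ offset S t)            ≡⟨ triple-flagged _ 0<rc (≤-<-trans rc≤rb (subst (λ s → rb < width s) S_t≡s12 rb<w)) ⟩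
    just true                              ∎
    where
    open ≡-Reasoning
    off≤c : offset S t ≤ c
    off≤c = ≤-trans (m≤m+n (offset S t) ra) (<⇒≤ a<c)
    c≡ : offset S t + (c ∸ offset S t) ≡ c
    c≡ = m+[n∸m]≡n off≤c
    rc≤rb : c ∸ offset S t ≤ rb
    rc≤rb = +-cancelˡ-≤ (offset S t) _ _ (subst (_≤ offset S t + rb) (sym c≡) c≤b)
    0<rc : 0 < c ∸ offset S t
    0<rc = m<n⇒0<n∸m (≤-<-trans (m≤m+n (offset S t) ra) a<c)

  module AfterOpener {j} (op : Opener (lookup S j)) where

    h : ℕ
    h = lastPos j

    rest : SVW (m ∸ suc (Fin.toℕ j))
    rest = after S j

    prefix : List (Sym × Bool)
    prefix = before S j ++ block (lookup S j)

    length-prefix : length prefix ≡ suc h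
    length-prefix = begin
      length prefix                                        ≡⟨ length-++ (before S j) ⟩
      length (before S j) + width (lookup S j)             ≡⟨ cong₂ _+_ (length-before S j) (sym (suc-pred-width op)) ⟩
      offset S j + suc (pred (width (lookup S j)))         ≡⟨ +-suc (offset S j) _ ⟩
      suc h                                                ∎
      where open ≡-Reasoning

    blocks≡ : blocks S ≡ prefix ++ blocks rest
    blocks≡ = trans (blocks-split S j) (sym (++-assoc (before S j) _ _))

    drop-after : drop (suc h) ws ≡ symbols rest
    drop-after = begin
      drop (suc h) (map proj₁ (blocks S))           ≡⟨ drop-map (suc h) (blocks S) ⟩
      map proj₁ (drop (suc h) (blocks S))           ≡⟨ cong (map proj₁ ∘ drop (suc h)) blocks≡ ⟩
      map proj₁ (drop (suc h) (prefix ++ blocks rest)) ≡⟨ cong (map proj₁) (drop-++ prefix (blocks rest) length-prefix) ⟩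
      symbols rest                                  ∎
      where open ≡-Reasoning

    glued-after : ∀ i → glued S (suc h + i) ≡ glued rest i
    glued-after i = cong (Maybe.map proj₂) (begin
      at (blocks S) (suc h + i)                         ≡⟨ cong (λ xs → at xs (suc h + i)) blocks≡ ⟩
      at (prefix ++ blocks rest) (suc h + i)            ≡⟨ at-++ʳ prefix (blocks rest) i length-prefix ⟩
      at (blocks rest) i                                ∎)
      where open ≡-Reasoning

    H-after : ∀ i → H (suc h + i) ≡ sucℤ (H h) ℤ.+ level 0ℤ (symbols rest) i
    H-after i = begin
      H (suc h + i)                                   ≡⟨ level-drop 0ℤ ws (suc h) i ⟩
      level (H (suc h)) (drop (suc h) ws) i           ≡⟨ level-from (H (suc h)) (drop (suc h) ws) i ⟩
      H (suc h) ℤ.+ level 0ℤ (drop (suc h) ws) i      ≡⟨ cong₂ (λ x xs → x ℤ.+ level 0ℤ xs i) (H-opn (proj₂ (opener⇒lastPos op))) drop-after ⟩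
      sucℤ (H h) ℤ.+ level 0ℤ (symbols rest) i        ∎
      where open ≡-Reasoning

-- φ₁ of a tail read off its levels

Stays≥0 : ∀ {k} → ℕ → Vec (Subset 2) k → Set
Stays≥0 d c = ∀ i → 0ℤ ℤ.≤ level (+ d) (symbols c) i

Stays≥0-exceptGlued : ∀ {k} → ℕ → Vec (Subset 2) k → Set
Stays≥0-exceptGlued d c =
  ∀ i → 0ℤ ℤ.≤ level (+ d) (symbols c) i ⊎ (level (+ d) (symbols c) i ≡ -1ℤ × glued c i ≡ just true)

module _ {P : ℕ → Set} where

  shift⇔ : P 0 → (∀ i → P i) ⇔ (∀ i → P (suc i))
  shift⇔ P0 = mk⇔ (λ all i → all (suc i)) (λ { all zero → P0 ; all (suc i) → all i })

  shift₃⇔ : P 0 → P 1 → P 2 → (∀ i → P i) ⇔ (∀ i → P (3 + i))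
  shift₃⇔ P0 P1 P2 = mk⇔ (λ all i → all (3 + i))
    (λ { all 0 → P0 ; all 1 → P1 ; all 2 → P2 ; all (suc (suc (suc i))) → all i })

∸≤⇔≤+ : ∀ m n o → m ∸ n ≤ o ⇔ m ≤ n + o
∸≤⇔≤+ m n o = mk⇔ (λ le → ≤-trans (m≤n+m∸n m n) (+-monoʳ-≤ n le)) (m≤n+o⇒m∸n≤o m n)

+-cancelˡ-≤⇔ : ∀ k m n → k + m ≤ k + n ⇔ m ≤ n
+-cancelˡ-≤⇔ k m n = mk⇔ (+-cancelˡ-≤ k m n) (+-monoʳ-≤ k)

glued-first : ∀ {k} (c : Vec (Subset 2) k) → glued c 0 ≢ just true
glued-first []                              ()
glued-first ((inside ∷ inside ∷ []) ∷ c)   ()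
glued-first ((inside ∷ outside ∷ []) ∷ c)  ()
glued-first ((outside ∷ inside ∷ []) ∷ c)  ()
glued-first ((outside ∷ outside ∷ []) ∷ c) = glued-first c

≤-congʳ⇔ : ∀ {m n o} → n ≡ o → m ≤ n ⇔ m ≤ o
≤-congʳ⇔ {m} n≡o = mk⇔ (subst (m ≤_) n≡o) (subst (m ≤_) (sym n≡o))

0≰-1 : ¬ (0ℤ ℤ.≤ -1ℤ)
0≰-1 ()

φ⊗≤2d⇔ : ∀ {k} (c : Vec (Subset 2) k) d → φ⊗ c ≤ 2 * d ⇔ Stays≥0 d c
φ⊗≤2d⇔ []                              d = mk⇔ (λ _ i → subst (0ℤ ℤ.≤_) (sym (level-[] (+ d) i)) (ℤ.+≤+ z≤n)) (λ _ → z≤n)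
φ⊗≤2d⇔ ((outside ∷ outside ∷ []) ∷ c) d = φ⊗≤2d⇔ c d
φ⊗≤2d⇔ ((inside ∷ outside ∷ []) ∷ c)  zero = mk⇔ (λ ()) (λ all → ⊥-elim (0≰-1 (all 1)))
φ⊗≤2d⇔ ((inside ∷ outside ∷ []) ∷ c)  (suc d) =
  ⇔-trans (⇔-trans (≤-congʳ⇔ (*-suc 2 d)) (+-cancelˡ-≤⇔ 2 _ _))
    (⇔-trans (φ⊗≤2d⇔ c d) (⇔-sym (shift⇔ (ℤ.+≤+ z≤n))))
φ⊗≤2d⇔ ((outside ∷ inside ∷ []) ∷ c)  d =
  ⇔-trans (⇔-trans (∸≤⇔≤+ (φ⊗ c) 2 (2 * d)) (≤-congʳ⇔ (sym (*-suc 2 d))))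
    (⇔-trans (φ⊗≤2d⇔ c (suc d)) (⇔-sym (shift⇔ (ℤ.+≤+ z≤n))))
φ⊗≤2d⇔ ((inside ∷ inside ∷ []) ∷ c)   zero = mk⇔ (λ ()) (λ all → ⊥-elim (0≰-1 (all 1)))
φ⊗≤2d⇔ ((inside ∷ inside ∷ []) ∷ c)   (suc d) =
  ⇔-trans arith (⇔-trans (φ⊗≤2d⇔ c (suc d)) (⇔-sym (shift₃⇔ (ℤ.+≤+ z≤n) (ℤ.+≤+ z≤n) (ℤ.+≤+ z≤n))))
  where
  arith : 1 + (φ⊗ c ∸ 1) ≤ 2 * suc d ⇔ φ⊗ c ≤ 2 * suc d
  arith = ⇔-trans (⇔-trans (≤-congʳ⇔ (*-suc 2 d)) (+-cancelˡ-≤⇔ 1 _ _))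
            (⇔-trans (∸≤⇔≤+ (φ⊗ c) 1 (1 + 2 * d)) (≤-congʳ⇔ (sym (*-suc 2 d))))

φ⊗≤1+2d⇔ : ∀ {k} (c : Vec (Subset 2) k) d → φ⊗ c ≤ suc (2 * d) ⇔ Stays≥0-exceptGlued d c
φ⊗≤1+2d⇔ []                              d = mk⇔ (λ _ i → inj₁ (subst (0ℤ ℤ.≤_) (sym (level-[] (+ d) i)) (ℤ.+≤+ z≤n))) (λ _ → z≤n)
φ⊗≤1+2d⇔ ((outside ∷ outside ∷ []) ∷ c) d = φ⊗≤1+2d⇔ c d
φ⊗≤1+2d⇔ ((inside ∷ outside ∷ []) ∷ c)  zero =
  mk⇔ (λ 2+φc≤1 → ⊥-elim (1+n≰n (≤-trans (m≤m+n 2 (φ⊗ c)) 2+φc≤1))) (λ all → ⊥-elim (dip (all 1)))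
  where
  dip : ¬ (0ℤ ℤ.≤ -1ℤ ⊎ (-1ℤ ≡ -1ℤ × glued c 0 ≡ just true))
  dip (inj₁ 0≤-1)       = 0≰-1 0≤-1
  dip (inj₂ (_ , g))    = glued-first c g
φ⊗≤1+2d⇔ ((inside ∷ outside ∷ []) ∷ c)  (suc d) =
  ⇔-trans (⇔-trans (≤-congʳ⇔ (cong suc (*-suc 2 d))) (+-cancelˡ-≤⇔ 2 _ _))
    (⇔-trans (φ⊗≤1+2d⇔ c d) (⇔-sym (shift⇔ (inj₁ (ℤ.+≤+ z≤n)))))
φ⊗≤1+2d⇔ ((outside ∷ inside ∷ []) ∷ c)  d =
  ⇔-trans (⇔-trans (∸≤⇔≤+ (φ⊗ c) 2 (suc (2 * d))) (≤-congʳ⇔ (sym (cong suc (*-suc 2 d)))))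
    (⇔-trans (φ⊗≤1+2d⇔ c (suc d)) (⇔-sym (shift⇔ (inj₁ (ℤ.+≤+ z≤n)))))
φ⊗≤1+2d⇔ ((inside ∷ inside ∷ []) ∷ c)   zero =
  ⇔-trans (⇔-trans (+-cancelˡ-≤⇔ 1 _ _) (∸≤⇔≤+ (φ⊗ c) 1 0))
    (⇔-trans (φ⊗≤1+2d⇔ c 0) (⇔-sym (shift₃⇔ (inj₁ (ℤ.+≤+ z≤n)) (inj₂ (refl , refl)) (inj₂ (refl , refl)))))
φ⊗≤1+2d⇔ ((inside ∷ inside ∷ []) ∷ c)   (suc d) =
  ⇔-trans (⇔-trans (+-cancelˡ-≤⇔ 1 _ _) (∸≤⇔≤+ (φ⊗ c) 1 (2 * suc d)))
    (⇔-trans (φ⊗≤1+2d⇔ c (suc d)) (⇔-sym (shift₃⇔ (inj₁ (ℤ.+≤+ z≤n)) (inj₁ (ℤ.+≤+ z≤n)) (inj₁ (ℤ.+≤+ z≤n)))))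

-- Classes and forms

module Classes {m} (S : SVW m) where

  open Word S
  private module O = OneWord S

  -- c − 1 and c are linked by a generator of the class relation; the classes are exactly the
  -- maximal intervals all of whose positions except the first are joined.
  Joined : ℕ → Set
  Joined zero    = ⊥
  Joined (suc c) = Spanned (suc c) ⊎ glued S (suc c) ≡ just true

  joined? : ∀ c → Dec (Joined c)
  joined? zero    = no λ ()
  joined? (suc c) = spanned? (suc c) ⊎-dec Maybeₚ.≡-dec Bool._≟_ (glued S (suc c)) (just true)

  joined⇒gen : ∀ c → Joined (suc c) → O.Gen c (suc c)
  joined⇒gen c (inj₁ (p , q , Mpq , p<1+c , 1+c≤q)) =
    O.inMatch p q (matched⇐ Mpq) (s≤s⁻¹ p<1+c) (≤-trans (n≤1+n c) 1+c≤q) (<⇒≤ p<1+c) 1+c≤q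
  joined⇒gen c (inj₂ g) with glued-suc⇒same-triple g
  ... | t , S_t≡s12 , src-c , src-1+c = O.inTriple t S_t≡s12 src-c src-1+c

  gen⇒joined : ∀ {a b c} → O.Gen a b → a < c → c ≤ b → Joined c
  gen⇒joined {c = suc c} (O.inMatch p q Mpq p≤a _ _ b≤q) a<c c≤b =
    inj₁ (p , q , matched⇒ Mpq , ≤-<-trans p≤a a<c , ≤-trans c≤b b≤q)
  gen⇒joined {c = suc c} (O.inTriple t S_t≡s12 src-a src-b) a<c c≤b =
    inj₂ (same-triple⇒glued S_t≡s12 src-a src-b a<c c≤b)

  gen-sym : ∀ {a b} → O.Gen a b → O.Gen b a
  gen-sym (O.inMatch p q Mpq p≤a a≤q p≤b b≤q) = O.inMatch p q Mpq p≤b b≤q p≤a a≤q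
  gen-sym (O.inTriple t S_t≡s12 src-a src-b)  = O.inTriple t S_t≡s12 src-b src-a

  same-below-cut : ∀ {a b c} → ¬ Joined c → O.Same a b → a < c → b < c
  same-below-cut cut ε             a<c = a<c
  same-below-cut cut (fwd g ◅ a~b) a<c = same-below-cut cut a~b (≰⇒> (cut ∘ gen⇒joined g a<c))
  same-below-cut cut (bwd g ◅ a~b) a<c = same-below-cut cut a~b (≰⇒> (cut ∘ gen⇒joined (gen-sym g) a<c))

  same-above-cut : ∀ {a b c} → ¬ Joined c → O.Same a b → c ≤ a → c ≤ b
  same-above-cut cut a~b c≤a = ≮⇒≥ (λ b<c → <⇒≱ (same-below-cut cut (EqClosure.symmetric O.Gen a~b) b<c) c≤a)

  joined⇒same : ∀ {lo} k → lo ≤ k → (∀ c → lo < c → c ≤ k → Joined c) → O.Same lo k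
  joined⇒same k lo≤k joined with m≤n⇒m<n∨m≡n lo≤k
  ... | inj₂ refl = ε
  joined⇒same (suc k) lo≤k joined | inj₁ lo<1+k =
    joined⇒same k (s≤s⁻¹ lo<1+k) (λ c lo<c c≤k → joined c lo<c (m≤n⇒m≤1+n c≤k))
      ◅◅ (fwd (joined⇒gen k (joined (suc k) lo<1+k ≤-refl)) ◅ ε)

  class-intro : ∀ {lo hi} → lo ≤ hi → ¬ Joined lo → ¬ Joined (suc hi) →
                (∀ c → lo < c → c ≤ hi → Joined c) → O.Class lo hi
  class-intro {lo} {hi} lo≤hi cut-lo cut-hi joined k = mk⇔
    (λ lo~k → same-above-cut cut-lo lo~k ≤-refl , s≤s⁻¹ (same-below-cut cut-hi lo~k (s≤s lo≤hi)))
    (λ { (lo≤k , k≤hi) → joined⇒same k lo≤k (λ c lo<c c≤k → joined c lo<c (≤-trans c≤k k≤hi)) })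

  not-joined : ∀ {x} → glued S x ≢ just true → ¬ Spanned x → ¬ Joined x
  not-joined {suc x} ¬glued ¬spanned (inj₁ spanned) = ¬spanned spanned
  not-joined {suc x} ¬glued ¬spanned (inj₂ g)       = ¬glued g

  spanned⇒joined : ∀ {x} → 0 < x → Spanned x → Joined x
  spanned⇒joined {suc x} _ = inj₁

  glued⇒joined : ∀ {x} → 0 < x → glued S x ≡ just true → Joined x
  glued⇒joined {suc x} _ = inj₂

  class-start : ∀ {lo hi} → O.Class lo hi → ¬ Joined lo
  class-start {suc l} class joined = 1+n≰n (proj₁ (Equivalence.to (class l) (bwd (joined⇒gen l joined) ◅ ε)))

  class-interior : ∀ {lo hi c} → O.Class lo hi → lo < c → c ≤ hi → Joined c
  class-interior {lo} {hi} {c} class lo<c c≤hi = decidable-stable (joined? c) λ cut →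
    <⇒≱ (same-below-cut cut (Equivalence.from (class hi) (≤-trans (<⇒≤ lo<c) c≤hi , ≤-refl)) lo<c) c≤hi

module Forms {m} (S : SVW m) where

  open Word S
  open Classes S
  private module O = OneWord S

  unmatchedOpen⇒ : ∀ {h} → O.UnmatchedOpen h → at ws h ≡ just opn × (∀ y → h < y → H h ℤ.< H y)
  unmatchedOpen⇒ {h} (opn-h , unmatched) =
    opn-h′ , no-match⇒above opn-h′ (λ q → unmatched q ∘ matched⇐)
    where
    opn-h′ : at ws h ≡ just opn
    opn-h′ = trans (sym (symAt≡ h)) opn-h

  unmatchedOpen⇐ : ∀ {h} → at ws h ≡ just opn → (∀ y → h < y → H h ℤ.< H y) → O.UnmatchedOpen h
  unmatchedOpen⇐ {h} opn-h above = trans (symAt≡ h) opn-h , λ q → above⇒no-match above q ∘ matched⇒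

  unmatchedClose⇒ : ∀ {k} → O.UnmatchedClose k → ∀ a → a ≤ k → H (suc k) ℤ.< H a
  unmatchedClose⇒ {k} (cls-k , unmatched) = no-match⇒below (trans (sym (symAt≡ k)) cls-k) (λ p → unmatched p ∘ matched⇐)

  unmatchedClose? : ∀ k → Dec (O.UnmatchedClose k)
  unmatchedClose? k with ≡just-cls? (at ws k) | anyUpTo? (λ a → H a ℤₚ.≤? H (suc k)) (suc k)
  ... | no ¬cls-k | _ = no (¬cls-k ∘ trans (sym (symAt≡ k)) ∘ proj₁)
  ... | yes _ | yes (a , a<1+k , Ha≤) = no λ uc → ℤₚ.<⇒≱ (unmatchedClose⇒ uc a (s≤s⁻¹ a<1+k)) Ha≤
  ... | yes cls-k | no none = yes (trans (symAt≡ k) cls-k ,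
    λ p → below⇒no-match (λ a a≤k → ℤₚ.≰⇒> (λ Ha≤ → none (a , s≤s a≤k , Ha≤))) p ∘ matched⇒)

  joined⇒not-unmatchedClose : ∀ {k} → Joined k → ¬ O.UnmatchedClose k
  joined⇒not-unmatchedClose {suc k} (inj₂ g) uc = glued⇒not-cls g (trans (sym (symAt≡ (suc k))) (proj₁ uc))
  joined⇒not-unmatchedClose {suc k} (inj₁ (p , q , Mpq , p<1+k , 1+k≤q)) uc with m≤n⇒m<n∨m≡n 1+k≤q
  ... | inj₂ refl  = proj₂ uc p (matched⇐ Mpq)
  ... | inj₁ 1+k<q = ℤₚ.<-asym (matched-above Mpq (m<n⇒m<1+n p<1+k) 1+k<q) (unmatchedClose⇒ uc p (<⇒≤ p<1+k))

  module AtOpener {j} (op : Opener (lookup S j)) where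

    open AfterOpener op public

    src-h : O.srcAt h ≡ just j
    src-h = proj₁ (opener⇒lastPos op)

    opn-h : at ws h ≡ just opn
    opn-h = proj₂ (opener⇒lastPos op)

    H-beyond : ∀ y → h < y → H y ≡ sucℤ (H h) ℤ.+ level 0ℤ (symbols rest) (y ∸ suc h)
    H-beyond y h<y = trans (cong H (sym (m+[n∸m]≡n h<y))) (H-after (y ∸ suc h))

    unmatched⇔φ≤0 : O.UnmatchedOpen h ⇔ φ⊗ rest ≤ 0
    unmatched⇔φ≤0 = mk⇔
      (λ uo → Equivalence.from (φ⊗≤2d⇔ rest 0) (λ i → +-cancelˡ-≤ℤ (sucℤ (H h)) (begin
        sucℤ (H h) ℤ.+ 0ℤ                            ≡⟨ ℤₚ.+-identityʳ _ ⟩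
        sucℤ (H h)                                   ≤⟨ ℤₚ.i<j⇒suc[i]≤j (proj₂ (unmatchedOpen⇒ uo) (suc h + i) (s≤s (m≤m+n h i))) ⟩
        H (suc h + i)                                ≡⟨ H-after i ⟩
        sucℤ (H h) ℤ.+ level 0ℤ (symbols rest) i     ∎)))
      (λ φ≤0 → unmatchedOpen⇐ opn-h λ y h<y → ℤₚ.suc[i]≤j⇒i<j (begin
        sucℤ (H h)                                   ≡⟨ ℤₚ.+-identityʳ _ ⟨
        sucℤ (H h) ℤ.+ 0ℤ                            ≤⟨ ℤₚ.+-monoʳ-≤ (sucℤ (H h)) (Equivalence.to (φ⊗≤2d⇔ rest 0) φ≤0 (y ∸ suc h)) ⟩
        sucℤ (H h) ℤ.+ level 0ℤ (symbols rest) (y ∸ suc h) ≡⟨ H-beyond y h<y ⟨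
        H y                                          ∎))
      where open ℤₚ.≤-Reasoning

    unmatched⇒end : O.UnmatchedOpen h → O.EndOfLeftOrCombined j
    unmatched⇒end uo with greatest (λ y → ¬? (joined? y)) h z≤n (λ ())
    ... | lo , _ , lo≤h , cut-lo , maximal = lo , h , form , src-h
      where
      joined : ∀ c → lo < c → c ≤ h → Joined c
      joined c lo<c c≤h = decidable-stable (joined? c) (maximal c lo<c c≤h)
      cut-end : ¬ Joined (suc h)
      cut-end (inj₂ g) = glued-suc⇒not-opn g opn-h
      cut-end (inj₁ (p , q , Mpq , p<1+h , 1+h≤q)) with m≤n⇒m<n∨m≡n (s≤s⁻¹ p<1+h)
      ... | inj₂ refl = proj₂ uo q (matched⇐ Mpq)
      ... | inj₁ p<h  = ℤₚ.<-asym (matched-above Mpq p<h (≤-trans (n≤1+n h) 1+h≤q))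
        (subst (H h ℤ.<_) (matched-closes Mpq) (proj₂ (unmatchedOpen⇒ uo) (suc q) (≤-trans 1+h≤q (n≤1+n q))))
      class : O.Class lo h
      class = class-intro lo≤h cut-lo cut-end joined
      form : O.LeftForm lo h ⊎ O.CombinedForm lo h
      form with unmatchedClose? lo
      ... | yes uc  = inj₂ (class , uc , uo)
      ... | no ¬uc = inj₁ (class , no-uc , uo)
        where
        no-uc : ∀ k → lo ≤ k → k ≤ h → ¬ O.UnmatchedClose k
        no-uc k lo≤k k≤h with m≤n⇒m<n∨m≡n lo≤k
        ... | inj₂ refl = ¬uc
        ... | inj₁ lo<k = joined⇒not-unmatchedClose (joined k lo<k k≤h)

    end⇔unmatched : O.EndOfLeftOrCombined j ⇔ O.UnmatchedOpen h
    end⇔unmatched = mk⇔ end⇒unmatched unmatched⇒end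
      where
      end⇒unmatched : O.EndOfLeftOrCombined j → O.UnmatchedOpen h
      end⇒unmatched (_ , hi , form , src-hi) = subst O.UnmatchedOpen (opn⇒lastPos src-hi (proj₁ (unmatchedOpen⇒ uo))) uo
        where
        uo : O.UnmatchedOpen hi
        uo = [ proj₂ ∘ proj₂ , proj₂ ∘ proj₂ ]′ form

    end⇔φ≤0 : O.EndOfLeftOrCombined j ⇔ φ⊗ rest ≤ 0
    end⇔φ≤0 = ⇔-trans end⇔unmatched unmatched⇔φ≤0

  module AtLoneOpener {j} (S_j≡s2 : lookup S j ≡ s2) where

    op : Opener (lookup S j)
    op = subst Opener (sym S_j≡s2) lone-opn

    open AtOpener op public

    D : ℤ
    D = H h

    Good : ℕ → Set
    Good y = sucℤ D ℤ.≤ H y ⊎ (H y ≡ D × glued S y ≡ just true)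

    good? : ∀ y → Dec (Good y)
    good? y = (sucℤ D ℤₚ.≤? H y) ⊎-dec ((H y ℤₚ.≟ D) ×-dec Maybeₚ.≡-dec Bool._≟_ (glued S y) (just true))

    good⇒D≤ : ∀ {y} → Good y → D ℤ.≤ H y
    good⇒D≤ (inj₁ 1+D≤Hy)  = ℤₚ.<⇒≤ (ℤₚ.suc[i]≤j⇒i<j 1+D≤Hy)
    good⇒D≤ (inj₂ (Hy≡D , _)) = ℤₚ.≤-reflexive (sym Hy≡D)

    1+D-1≡D : sucℤ D ℤ.+ -1ℤ ≡ D
    1+D-1≡D = trans (ℤₚ.+-comm (sucℤ D) -1ℤ) (ℤₚ.pred-suc D)

    almost⇔good : Stays≥0-exceptGlued 0 rest ⇔ (∀ y → h < y → Good y)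
    almost⇔good = mk⇔ (λ almost y h<y → subst Good (m+[n∸m]≡n h<y) (tail⇒good (almost (y ∸ suc h))))
                      (λ good i → good⇒tail (good (suc h + i) (s≤s (m≤m+n h i))))
      where
      tail⇒good : ∀ {i} → 0ℤ ℤ.≤ level 0ℤ (symbols rest) i ⊎ (level 0ℤ (symbols rest) i ≡ -1ℤ × glued rest i ≡ just true) →
           Good (suc h + i)
      tail⇒good {i} (inj₁ 0≤lvl) = inj₁ (begin
        sucℤ D                                   ≡⟨ ℤₚ.+-identityʳ _ ⟨
        sucℤ D ℤ.+ 0ℤ                            ≤⟨ ℤₚ.+-monoʳ-≤ (sucℤ D) 0≤lvl ⟩
        sucℤ D ℤ.+ level 0ℤ (symbols rest) i     ≡⟨ H-after i ⟨
        H (suc h + i)                            ∎)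
        where open ℤₚ.≤-Reasoning
      tail⇒good {i} (inj₂ (lvl≡-1 , g)) =
        inj₂ (trans (H-after i) (trans (cong (λ x → sucℤ D ℤ.+ x) lvl≡-1) 1+D-1≡D) , trans (glued-after i) g)
      good⇒tail : ∀ {i} → Good (suc h + i) →
             0ℤ ℤ.≤ level 0ℤ (symbols rest) i ⊎ (level 0ℤ (symbols rest) i ≡ -1ℤ × glued rest i ≡ just true)
      good⇒tail {i} (inj₁ 1+D≤H) = inj₁ (+-cancelˡ-≤ℤ (sucℤ D) (begin
        sucℤ D ℤ.+ 0ℤ                            ≡⟨ ℤₚ.+-identityʳ _ ⟩
        sucℤ D                                   ≤⟨ 1+D≤H ⟩
        H (suc h + i)                            ≡⟨ H-after i ⟩
        sucℤ D ℤ.+ level 0ℤ (symbols rest) i     ∎))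
        where open ℤₚ.≤-Reasoning
      good⇒tail {i} (inj₂ (H≡D , g)) =
        inj₂ (+-cancelˡ-≡ℤ (sucℤ D) _ _ (trans (sym (H-after i)) (trans H≡D (sym 1+D-1≡D))) , trans (sym (glued-after i)) g)

    h-not-glued : glued S h ≢ just true
    h-not-glued g with trans (sym (trans (glued-block (pred-width< op)) (cong (λ s → flagAt s (pred (width s))) S_j≡s2))) g
    ... | ()

    module LeftFormFromGood (good : ∀ y → h < y → Good y) {hi} (h≤hi : h ≤ hi) (Hhi≤D : H hi ℤ.≤ D)
                            (maximal : ∀ z → hi < z → z ≤ pred (length ws) → ¬ (H z ℤ.≤ D)) where

      D<H : ∀ y → hi < y → D ℤ.< H y
      D<H y hi<y with good y (≤-<-trans h≤hi hi<y)
      ... | inj₁ 1+D≤Hy     = ℤₚ.suc[i]≤j⇒i<j 1+D≤Hy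
      ... | inj₂ (Hy≡D , g) = ⊥-elim (maximal y hi<y (<⇒≤pred (glued⇒< g)) (ℤₚ.≤-reflexive Hy≡D))

      Hhi≡D : H hi ≡ D
      Hhi≡D with m≤n⇒m<n∨m≡n h≤hi
      ... | inj₂ refl = refl
      ... | inj₁ h<hi = ℤₚ.≤-antisym Hhi≤D (good⇒D≤ (good hi h<hi))

      opn-hi : at ws hi ≡ just opn
      opn-hi = proj₁ (move-up (at ws hi) Hhi≤D (subst (D ℤ.<_) (H-suc hi) (D<H (suc hi) ≤-refl)))

      unmatched-hi : O.UnmatchedOpen hi
      unmatched-hi = unmatchedOpen⇐ opn-hi (λ y hi<y → subst (ℤ._< H y) (sym Hhi≡D) (D<H y hi<y))

      cut-h : ¬ Joined h
      cut-h = not-joined h-not-glued λ (p , q , Mpq , p<h , h≤q) →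
        ℤₚ.<⇒≱ (subst (ℤ._< D) (sym (matched-closes Mpq)) (matched-above Mpq p<h h≤q)) (good⇒D≤ (good (suc q) (s≤s h≤q)))

      cut-end : ¬ Joined (suc hi)
      cut-end (inj₂ g) = glued-suc⇒not-opn g opn-hi
      cut-end (inj₁ (p , q , Mpq , p<1+hi , 1+hi≤q)) =
        ℤₚ.<⇒≱ (D<H (suc q) (≤-trans 1+hi≤q (n≤1+n q))) (subst (ℤ._≤ D) (sym (matched-closes Mpq)) Hp≤D)
        where
        Hp≤D : H p ℤ.≤ D
        Hp≤D with m≤n⇒m<n∨m≡n (s≤s⁻¹ p<1+hi)
        ... | inj₂ refl = ℤₚ.≤-reflexive Hhi≡D
        ... | inj₁ p<hi = ℤₚ.<⇒≤ (subst (H p ℤ.<_) Hhi≡D (matched-above Mpq p<hi (s≤s⁻¹ (m<n⇒m<1+n 1+hi≤q))))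

      joined : ∀ c → h < c → c ≤ hi → Joined c
      joined c h<c c≤hi with good c h<c
      ... | inj₂ (_ , g)  = glued⇒joined (≤-<-trans z≤n h<c) g
      ... | inj₁ 1+D≤Hc = spanned⇒joined (≤-<-trans z≤n h<c)
        (spanning h<c c<hi (ℤₚ.suc[i]≤j⇒i<j 1+D≤Hc) (ℤₚ.≤-reflexive Hhi≡D))
        where
        c<hi : c < hi
        c<hi = ≤∧≢⇒< c≤hi λ { refl → ℤₚ.<⇒≱ (ℤₚ.suc[i]≤j⇒i<j 1+D≤Hc) Hhi≤D }

      no-unmatchedClose : ∀ k → h ≤ k → k ≤ hi → ¬ O.UnmatchedClose k
      no-unmatchedClose k h≤k _ uc = ℤₚ.<⇒≱ (unmatchedClose⇒ uc h h≤k) (good⇒D≤ (good (suc k) (s≤s h≤k)))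

      left-form : O.LeftForm h hi
      left-form = class-intro h≤hi cut-h cut-end joined , no-unmatchedClose , unmatched-hi

    good⇒start : (∀ y → h < y → Good y) → O.StartOfLeft j
    good⇒start good with greatest (λ y → H y ℤₚ.≤? D) (pred (length ws)) (<⇒≤pred (source⇒< src-h)) ℤₚ.≤-refl
    ... | hi , h≤hi , _ , Hhi≤D , maximal = h , hi , LeftFormFromGood.left-form good h≤hi Hhi≤D maximal , src-h

    -- A first violation of Good after h can lie neither inside the class [h, hi], where it would be
    -- joined to its predecessor, nor beyond hi, where the walk would fall back to the level of the
    -- unmatched "(" at hi.
    module NoFirstBad {hi} (class : O.Class h hi) (unmatched-hi : O.UnmatchedOpen hi) {b} (h<B : h < suc b)
                      (¬good : ¬ Good (suc b)) (good-below : ∀ z → h < z → z < suc b → Good z) where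

      D≤H : ∀ z → h ≤ z → z < suc b → D ℤ.≤ H z
      D≤H z h≤z z<B with m≤n⇒m<n∨m≡n h≤z
      ... | inj₂ refl = ℤₚ.≤-refl
      ... | inj₁ h<z  = good⇒D≤ (good-below z h<z z<B)

      HB≤D : H (suc b) ℤ.≤ D
      HB≤D = i<suc[j]⇒i≤j (ℤₚ.≰⇒> (¬good ∘ inj₁))

      spanned-case : Spanned (suc b) → ⊥
      spanned-case (p , q , Mpq , p<B , B≤q) with h ≤? p
      ... | yes h≤p = ℤₚ.<⇒≱ (ℤₚ.≤-<-trans (D≤H p h≤p p<B) (matched-above Mpq p<B B≤q)) HB≤D
      ... | no  h≰p = class-start class (spanned⇒joined (≤-<-trans z≤n (≰⇒> h≰p))
                        (p , q , Mpq , ≰⇒> h≰p , ≤-trans (<⇒≤ h<B) B≤q))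

      h<b : at ws b ≡ just cls → h < b
      h<b cls-b = ≤∧≢⇒< (s≤s⁻¹ h<B) λ h≡b → opn≢cls (trans (sym opn-h) (subst (λ x → at ws x ≡ just cls) (sym h≡b) cls-b))
        where
        opn≢cls : just opn ≢ just cls
        opn≢cls ()

      dropped-below : H (suc b) ℤ.< D → ⊥
      dropped-below HB<D with move-down (at ws b) (ℤₚ.<-≤-trans HB<D (D≤H b (s≤s⁻¹ h<B) ≤-refl)) (ℤₚ.≤-reflexive (sym (H-suc b)))
      ... | cls-b , _ with good-below b (h<b cls-b) ≤-refl
      ...   | inj₁ 1+D≤Hb = ℤₚ.<⇒≱ HB<D (subst₂ ℤ._≤_ (ℤₚ.pred-suc D) (sym (H-cls cls-b)) (ℤₚ.pred-mono 1+D≤Hb))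
      ...   | inj₂ (_ , g) = glued⇒not-cls g cls-b

      glued-case : glued S (suc b) ≡ just true → ⊥
      glued-case g with H (suc b) ℤₚ.≟ D
      ... | yes HB≡D = ¬good (inj₂ (HB≡D , g))
      ... | no  HB≢D = dropped-below (ℤₚ.≤∧≢⇒< HB≤D HB≢D)

      impossible : ⊥
      impossible with suc b ≤? hi
      ... | yes B≤hi = [ spanned-case , glued-case ]′ (class-interior class h<B B≤hi)
      ... | no  B≰hi = ℤₚ.<⇒≱ (proj₂ (unmatchedOpen⇒ unmatched-hi) (suc b) (≰⇒> B≰hi))
                              (ℤₚ.≤-trans HB≤D (D≤H hi (proj₂ (Equivalence.to (class h) ε)) (≰⇒> B≰hi)))

    start⇒good : O.StartOfLeft j → ∀ y → h < y → Good y
    start⇒good (lo , hi , (class , _ , unmatched-hi) , src-lo) y h<y = decidable-stable (good? y) λ ¬good-y →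
      first-bad (least (λ z → (h <? z) ×-dec ¬? (good? z)) (h<y , ¬good-y))
      where
      class-h : O.Class h hi
      class-h = subst (λ x → O.Class x hi) (lone⇒lastPos S_j≡s2 src-lo) class
      first-bad : ¬ (∃[ B ] B ≤ y × (h < B × ¬ Good B) × (∀ z → z < B → ¬ (h < z × ¬ Good z)))
      first-bad (suc b , _ , (h<B , ¬good-B) , minimal) = NoFirstBad.impossible class-h unmatched-hi h<B ¬good-B
        (λ z h<z z<B → decidable-stable (good? z) (λ ¬good-z → minimal z z<B (h<z , ¬good-z)))

    start⇔φ≤1 : O.StartOfLeft j ⇔ φ⊗ rest ≤ 1
    start⇔φ≤1 = ⇔-trans (mk⇔ start⇒good good⇒start) (⇔-sym (⇔-trans (φ⊗≤1+2d⇔ rest 0) almost⇔good))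

e₁^-fixed : ∀ {b} k → e₁ b ≡ nothing → e₁^ k b ≡ b
e₁^-fixed zero    _ = refl
e₁^-fixed {b} (suc k) eq with e₁ b
e₁^-fixed (suc k) refl | nothing = refl

module Position {m} (S : SVW m) (j : Fin m) where

  private module O = OneWord S

  Prescribed : Subset 2 → Subset 2 → Set
  Prescribed s v = (one ∈ v ⇔ (one ∈ s ⊎ O.StartOfLeft j)) × (two ∈ v ⇔ (two ∈ s × ¬ O.EndOfLeftOrCombined j))

  prescribed-∅ : lookup S j ≡ s∅ → ∀ k → Prescribed s∅ (e₁^ k s∅)
  prescribed-∅ S_j≡∅ k rewrite e₁^-fixed {s∅} k refl =
    mk⇔ (λ ()) (λ { (inj₁ ()) ; (inj₂ (_ , _ , _ , src)) → ⊥-elim (Word.source⇒nonempty S src S_j≡∅) }) ,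
    mk⇔ (λ { (there ()) }) (λ { (there () , _) })

  prescribed-1 : ∀ k → Prescribed s1 (e₁^ k s1)
  prescribed-1 k rewrite e₁^-fixed {s1} k refl =
    mk⇔ (λ _ → inj₁ here) (λ _ → here) , mk⇔ (λ { (there ()) }) (λ { (there () , _) })

  prescribed-2 : lookup S j ≡ s2 → Prescribed s2 (e₁^ (2 ∸ φ⊗ (after S j)) s2)
  prescribed-2 S_j≡s2 with φ⊗ (after S j) | start⇔φ≤1 | end⇔φ≤0
    where open Forms.AtLoneOpener S S_j≡s2
  ... | 0 | start⇔ | end⇔ =
    mk⇔ (λ _ → inj₂ (Equivalence.from start⇔ z≤n)) (λ _ → here) ,
    mk⇔ (λ { (there ()) }) (λ (_ , ¬end) → ⊥-elim (¬end (Equivalence.from end⇔ z≤n)))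
  ... | 1 | start⇔ | end⇔ =
    mk⇔ (λ _ → inj₂ (Equivalence.from start⇔ (s≤s z≤n))) (λ _ → here) ,
    mk⇔ (λ _ → there here , n≮0 ∘ Equivalence.to end⇔) (λ _ → there here)
  ... | suc (suc p) | start⇔ | end⇔ rewrite 0∸n≡0 p =
    mk⇔ (λ ()) (λ { (inj₁ ()) ; (inj₂ start) → ⊥-elim (n≮0 (s≤s⁻¹ (Equivalence.to start⇔ start))) }) ,
    mk⇔ (λ _ → there here , n≮0 ∘ Equivalence.to end⇔) (λ _ → there here)

  prescribed-12 : lookup S j ≡ s12 → Prescribed s12 (e₁^ (1 ∸ φ⊗ (after S j)) s12)
  prescribed-12 S_j≡s12 with φ⊗ (after S j) | end⇔φ≤0
    where open Forms.AtOpener S (subst Opener (sym S_j≡s12) triple)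
  ... | 0 | end⇔ =
    mk⇔ (λ _ → inj₁ here) (λ _ → here) ,
    mk⇔ (λ { (there ()) }) (λ (_ , ¬end) → ⊥-elim (¬end (Equivalence.from end⇔ z≤n)))
  ... | suc p | end⇔ rewrite 0∸n≡0 p =
    mk⇔ (λ _ → inj₁ here) (λ _ → here) ,
    mk⇔ (λ _ → there here , n≮0 ∘ Equivalence.to end⇔) (λ _ → there here)

  prescribed : Prescribed (lookup S j) (lookup (E⊗ S) j)
  prescribed rewrite lookup-E⊗ S j with lookup S j in S_j≡
  ... | outside ∷ outside ∷ [] = prescribed-∅ S_j≡ (0 ∸ φ⊗ (after S j))
  ... | inside ∷ outside ∷ []  = prescribed-1 (0 ∸ φ⊗ (after S j))
  ... | outside ∷ inside ∷ []  = prescribed-2 S_j≡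
  ... | inside ∷ inside ∷ []   = prescribed-12 S_j≡

lemma2p19 : (m : ℕ) (S : SVW m) →
    ∃[ S′ ] (E₁ S ≡ just S′
      × ((j : Fin m) →
           (one ∈ lookup S′ j ⇔ (one ∈ lookup S j ⊎ OneWord.StartOfLeft S j))
         × (two ∈ lookup S′ j ⇔ (two ∈ lookup S j × ¬ OneWord.EndOfLeftOrCombined S j))))
lemma2p19 m S = E⊗ S , E₁≡E⊗ S , Position.prescribed S
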